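{- Let $\mathcal{M}$ be an oriented matroid on $E$ with underlying matroid $M$. Let $\tau$ be a codimension one face of the matroid fan $\Sigma_M$ and let $\sigma_1,\dots,\sigma_k$ be the facets of $\Sigma_M$ containing $\tau$. Then the sets $\mathcal{E}_{\mathcal{M}}(\sigma_1),\dots,\mathcal{E}_{\mathcal{M}}(\sigma_k)$ form an even covering, i.e. every element of their union lies in an even number of them.
   Context: Matroid fan: for a loopfree matroid $M$ on $E$, $v_i=-e_i\in\mathbb{R}^E$, $v_I=\sum_{i\in I}v_i$; for each chain of flats $\mathcal{F}=\{\emptyset\subsetneq F_1\subsetneq\dots\subsetneq F_k\subsetneq E\}$, $\sigma_{\mathcal{F}}$ is the cone generated by $v_{F_1},\dots,v_{F_k},v_E,-v_E$; $\Sigma_M$ consists of these cones, facets correspond to maximal chains. If $M$ has loops $L$, $\Sigma_M:=\Sigma_{M/L}\subset\mathbb{R}^{E\setminus L}$. An oriented matroid $\mathcal{M}$ is given by its covectors $\mathcal{C}\subseteq\{0,+1,-1\}^E$; its underlying matroid has flats $E\setminus\mathrm{Supp}(X)$, $X\in\mathcal{C}$. Topes are maximal covectors for the order $0<+1,-1$. $T\setminus F$ is $T$ with coordinates in $F$ set to $0$; for a chain of flats $\mathcal{F}$, $\mathcal{T}(\mathcal{F})$ is the set of topes $T$ with $T\setminus F\in\mathcal{C}$ for every flat $F$ in $\mathcal{F}$. $\mathbb{Z}_2=\mathbb{Z}/2\mathbb{Z}$ and $(-1)^\varepsilon=((-1)^{\varepsilon_e})_e$. For loopfree $\mathcal{M}$,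 $\mathcal{E}_{\mathcal{M}}(\sigma_{\mathcal{F}})=\{\varepsilon\in\mathbb{Z}_2^E:(-1)^\varepsilon\in\mathcal{T}(\mathcal{F})\}$ for facets $\sigma_{\mathcal{F}}$; if $\mathcal{M}$ has loops $L$, $\mathcal{E}_{\mathcal{M}}:=\mathcal{E}_{\mathcal{M}\setminus L}$ with values in $\mathbb{Z}_2^{E\setminus L}$. -}

module Defs where

open import Data.Nat using (ℕ; suc; _≤_)
open import Data.Bool using (Bool; true; false)
import Data.Bool
open import Data.Fin using (Fin)
import Data.Fin.Properties
open import Data.Vec using (Vec; lookup; replicate; map; zipWith)
open import Data.Vec.Properties using (≡-dec)
open import Data.Vec.Relation.Binary.Pointwise.Inductive using (Pointwise)
import Data.Vec.Relation.Binary.Pointwise.Inductive as PW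
open import Data.List using (List; length)
open import Data.List.Membership.Propositional using (_∈_)
open import Data.List.Relation.Binary.Subset.Propositional renaming (_⊆_ to _⊆ₗ_)
open import Data.List.Relation.Unary.All using (All; all?)
open import Data.List.Relation.Unary.Any using (Any; any?)
open import Data.List.Relation.Unary.Linked using (Linked)
open import Data.Fin.Subset using (Subset; ⊤) renaming (_∈_ to _∈ₛ_; _⊂_ to _⊂ₛ_)
open import Data.Product using (Σ; ∃; _×_; _,_)
open import Data.Sum using (_⊎_)
open import Relation.Binary.PropositionalEquality using (_≡_; _≢_; refl)
open import Relation.Binary.Definitions using (DecidableEquality)
open import Relation.Nullary using (¬_; Dec; yes; no; _×-dec_; _→-dec_; ¬?)
import Data.List.Membership.DecPropositional as DecMem

data Sgn : Set where
  0ₛ +ₛ -ₛ : Sgn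

_≟ₛ_ : DecidableEquality Sgn
0ₛ ≟ₛ 0ₛ = yes refl
0ₛ ≟ₛ +ₛ = no λ ()
0ₛ ≟ₛ -ₛ = no λ ()
+ₛ ≟ₛ 0ₛ = no λ ()
+ₛ ≟ₛ +ₛ = yes refl
+ₛ ≟ₛ -ₛ = no λ ()
-ₛ ≟ₛ 0ₛ = no λ ()
-ₛ ≟ₛ +ₛ = no λ ()
-ₛ ≟ₛ -ₛ = yes refl

SignVec : ℕ → Set
SignVec n = Vec Sgn n

_≟ᵥ_ : ∀ {n} → DecidableEquality (SignVec n)
_≟ᵥ_ = ≡-dec _≟ₛ_

negₛ : Sgn → Sgn
negₛ 0ₛ = 0ₛ
negₛ +ₛ = -ₛ
negₛ -ₛ = +ₛ

neg : ∀ {n} → SignVec n → SignVec n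
neg = map negₛ

compₛ : Sgn → Sgn → Sgn
compₛ 0ₛ t = t
compₛ +ₛ _ = +ₛ
compₛ -ₛ _ = -ₛ

_∘ᵥ_ : ∀ {n} → SignVec n → SignVec n → SignVec n
_∘ᵥ_ = zipWith compₛ

Sep : ∀ {n} → SignVec n → SignVec n → Fin n → Set
Sep X Y e = (lookup X e ≡ +ₛ × lookup Y e ≡ -ₛ) ⊎ (lookup X e ≡ -ₛ × lookup Y e ≡ +ₛ)

data _≤ₛ_ : Sgn → Sgn → Set where
  0≤ : ∀ {s} → 0ₛ ≤ₛ s
  refl≤ : ∀ {s} → s ≤ₛ s

_≤ₛ?_ : (s t : Sgn) → Dec (s ≤ₛ t)
0ₛ ≤ₛ? t = yes 0≤
+ₛ ≤ₛ? 0ₛ = no λ ()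
+ₛ ≤ₛ? +ₛ = yes refl≤
+ₛ ≤ₛ? -ₛ = no λ ()
-ₛ ≤ₛ? 0ₛ = no λ ()
-ₛ ≤ₛ? +ₛ = no λ ()
-ₛ ≤ₛ? -ₛ = yes refl≤

_≤ᵥ_ : ∀ {n} → SignVec n → SignVec n → Set
_≤ᵥ_ = Pointwise _≤ₛ_

_≤ᵥ?_ : ∀ {n} (X Y : SignVec n) → Dec (X ≤ᵥ Y)
_≤ᵥ?_ = PW.decidable _≤ₛ?_

-- Oriented matroids on E = Fin n, given by their (finite) set of
-- covectors, subject to the covector axioms (V0)-(V3)
-- (Björner–Las Vergnas–Sturmfels–White–Ziegler, Def. 3.7.1).

record OrientedMatroid (n : ℕ) : Set where
  field
    covectors : List (SignVec n)
    V0 : replicate n 0ₛ ∈ covectors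
    V1 : ∀ X → X ∈ covectors → neg X ∈ covectors
    V2 : ∀ X Y → X ∈ covectors → Y ∈ covectors → (X ∘ᵥ Y) ∈ covectors
    V3 : ∀ X Y → X ∈ covectors → Y ∈ covectors → ∀ e → Sep X Y e →
         ∃ λ Z → Z ∈ covectors × lookup Z e ≡ 0ₛ ×
                 (∀ f → ¬ Sep X Y f → lookup Z f ≡ lookup (X ∘ᵥ Y) f)

open OrientedMatroid public

module _ {n : ℕ} (𝓜 : OrientedMatroid n) where

  open DecMem (_≟ᵥ_ {n}) using (_∈?_)

  _∈𝓒 : SignVec n → Set
  X ∈𝓒 = X ∈ covectors 𝓜

  isZero : Sgn → Bool
  isZero 0ₛ = true
  isZero +ₛ = false
  isZero -ₛ = false

  zeroSet : SignVec n → Subset n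
  zeroSet = map isZero

  -- flats of the underlying matroid M: the sets E ∖ Supp(X), X a covector
  IsFlat : Subset n → Set
  IsFlat F = Any (λ X → zeroSet X ≡ F) (covectors 𝓜)

  Loop : Fin n → Set
  Loop e = All (λ X → lookup X e ≡ 0ₛ) (covectors 𝓜)

  loop? : ∀ e → Dec (Loop e)
  loop? e = all? (λ X → lookup X e ≟ₛ 0ₛ) (covectors 𝓜)

  -- flats F of M with ∅ ⊊ F ∖ L ⊊ E ∖ L, i.e. the proper nonempty flats of M/L
  ProperFlat : Subset n → Set
  ProperFlat F = IsFlat F × F ≢ ⊤ × ∃ λ e → e ∈ₛ F × ¬ Loop e

  -- chains of flats  ∅ ⊊ F₁ ⊊ ⋯ ⊊ F_k ⊊ E  (of M/L), as strictly increasing lists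
  IsChain : List (Subset n) → Set
  IsChain 𝓕 = All ProperFlat 𝓕 × Linked _⊂ₛ_ 𝓕

  -- the cone σ_𝓕 has dimension |𝓕| + 1; faces of σ_𝓕 are the σ_𝓖 with 𝓖 ⊆ 𝓕.
  -- facets of Σ_M: cones of maximal chains
  IsFacet : List (Subset n) → Set
  IsFacet 𝓕 = IsChain 𝓕 × (∀ 𝓖 → IsChain 𝓖 → 𝓕 ⊆ₗ 𝓖 → 𝓖 ⊆ₗ 𝓕)

  -- σ_𝓒 is a codimension one face: dim σ_𝓒 = dim Σ_M − 1, where
  -- dim Σ_M is the maximal dimension |𝓕| + 1 of a cone of Σ_M
  IsCodimOneFace : List (Subset n) → Set
  IsCodimOneFace 𝓒 = IsChain 𝓒
    × (∃ λ 𝓕 → IsChain 𝓕 × length 𝓕 ≡ suc (length 𝓒))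
    × (∀ 𝓖 → IsChain 𝓖 → length 𝓖 ≤ suc (length 𝓒))

  IsTope : SignVec n → Set
  IsTope T = T ∈𝓒 × All (λ Y → T ≤ᵥ Y → T ≡ Y) (covectors 𝓜)

  _∖ₜ_ : SignVec n → Subset n → SignVec n
  T ∖ₜ F = zipWith (λ t b → Data.Bool.if b then 0ₛ else t) T F

  InTopes : List (Subset n) → SignVec n → Set
  InTopes 𝓕 T = IsTope T × All (λ F → (T ∖ₜ F) ∈𝓒) 𝓕

  pm : Bool → Sgn
  pm false = +ₛ
  pm true  = -ₛ

  Matches : Vec Bool n → SignVec n → Set
  Matches ε T = ∀ e → (Loop e → lookup T e ≡ 0ₛ) × (¬ Loop e → lookup T e ≡ pm (lookup ε e))

  -- ε ∈ ℰ_𝓜(σ_𝓕)   (ε ∈ ℤ₂^{E∖L} represented by ε : Vec Bool n with ε = 0 on L)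
  InE : List (Subset n) → Vec Bool n → Set
  InE 𝓕 ε = Any (λ T → InTopes 𝓕 T × Matches ε T) (covectors 𝓜)

  inE? : ∀ 𝓕 ε → Dec (InE 𝓕 ε)
  inE? 𝓕 ε = any? (λ T → (tope? T ×-dec all? (λ F → (T ∖ₜ F) ∈? covectors 𝓜) 𝓕)
                          ×-dec all?ᶠ (λ e → (loop? e →-dec (lookup T e ≟ₛ 0ₛ))
                                           ×-dec (¬? (loop? e) →-dec (lookup T e ≟ₛ pm (lookup ε e)))))
                  (covectors 𝓜)
    where
      all?ᶠ = Data.Fin.Properties.all?
      tope? : ∀ T → Dec (IsTope T)
      tope? T = (T ∈? covectors 𝓜) ×-dec all? (λ Y → (T ≤ᵥ? Y) →-dec (T ≟ᵥ Y)) (covectors 𝓜)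

{-# OPTIONS --safe #-}

-- Fix the tope T that agrees with (-1)^ε off the loops: ε lies in ℰ(σ_𝓕) exactly when
-- T ∖ F is a covector for every F ∈ 𝓕.  A facet through the codimension one face τ is τ
-- with one flat H inserted, and two insertable flats are never nested, since inserting
-- both would beat the maximal chain length.  By the Jordan–Dedekind property of the
-- lattice of flats (the closure of h ∪ {e} is strictly monotone in h, by covector
-- elimination) some gap A ⊂ B of the chain loops ⊂ τ ⊂ E contains a flat, and then every
-- insertable flat lies in that gap.  The admissible ones are the zero sets of the
-- covectors Y with T ∖ B ≤ Y ≤ T ∖ A.  Elimination turns a flat of the gap into one such
-- Y and that Y into a second one, while a third would give a chain of length three in
-- the gap.  So exactly two facets through τ contain ε.

module Submission where

open import Defs

open import Data.Bool using (Bool; true; false; if_then_else_) renaming (_≟_ to _≟ᵇ_)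
open import Data.Bool.Properties using (T-≡)
open import Data.Empty using (⊥; ⊥-elim)
open import Data.Fin using (Fin)
import Data.Fin.Properties as Fin
open import Data.Fin.Subset using (Subset; ⊤; _∪_; ⁅_⁆)
  renaming (_∈_ to _∈ₛ_; _∉_ to _∉ₛ_; _⊆_ to _⊆ₛ_; _⊂_ to _⊂ₛ_)
open import Data.Fin.Subset.Induction using (⊂-wellFounded)
open import Data.Fin.Subset.Properties
  using (_∈?_; _⊆?_; _⊂?_; ⊆-trans; ⊆-antisym; ⊂-trans; ⊂-irref; ⊆-⊂-trans; ⊂-⊆-trans; ∈⊤; ⊆⊤;
         p⊆p∪q; q⊆p∪q; x∈p∪q⁻; x∈⁅x⁆; x∈⁅y⁆⇒x≡y)
open import Data.List using (List; []; _∷_; _++_; _∷ʳ_; length; filter; foldr)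
open import Data.List.Membership.Propositional using (_∈_; _∉_; find; lose)
open import Data.List.Membership.Propositional.Properties
  using (∈-∃++; ∈-++⁻; ∈-++⁺ˡ; ∈-++⁺ʳ; ∈-filter⁺; ∈-filter⁻)
open import Data.List.Properties using (length-++-sucʳ; length-++-comm)
open import Data.List.Relation.Binary.Subset.Propositional using (_⊆_)
open import Data.List.Relation.Unary.All using (All; []; _∷_)
import Data.List.Relation.Unary.All as All
open import Data.List.Relation.Unary.All.Properties using (¬All⇒Any¬) renaming (++⁺ to All-++⁺)
open import Data.List.Relation.Unary.AllPairs using (AllPairs; []; _∷_)
import Data.List.Relation.Unary.AllPairs as AllPairs
open import Data.List.Relation.Unary.Any using (Any; here; there)
import Data.List.Relation.Unary.Any as Any
open import Data.List.Relation.Unary.Linked using (Linked; []; [-]; _∷_)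
import Data.List.Relation.Unary.Linked as Linked
open import Data.List.Relation.Unary.Linked.Properties using (Linked⇒AllPairs)
open import Data.List.Relation.Unary.Unique.Propositional using (Unique)
open import Data.List.Relation.Unary.Unique.Propositional.Properties using (filter⁺)
open import Data.Nat using (ℕ; suc; _≤_; _<_; z≤n; s≤s; s≤s⁻¹)
open import Data.Nat.Divisibility using (_∣_; ∣-refl)
open import Data.Nat.Properties using (≤-refl; ≤-trans; ≤-antisym; ≤-reflexive; <⇒≱; <-irrefl)
open import Data.Product using (∃; _×_; _,_; proj₁; proj₂)
open import Data.Sum using (_⊎_; inj₁; inj₂; [_,_]′)
import Data.Sum as Sum
open import Data.Vec using (Vec; lookup; tabulate; replicate)
open import Data.Vec.Properties
  using (≡-dec; lookup-zipWith; lookup-map; lookup-replicate; tabulate∘lookup; tabulate-cong; lookup∘tabulate;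
         []=⇒lookup; lookup⇒[]=)
open import Data.Vec.Relation.Binary.Pointwise.Extensional using (ext; extensional⇒inductive)
open import Function using (id; _∘_)
open import Function.Bundles using (Equivalence)
open import Induction.WellFounded using (Acc; acc)
open import Relation.Binary.Definitions using (DecidableEquality; Decidable; Transitive; Irreflexive)
open import Relation.Binary.PropositionalEquality
  using (_≡_; _≢_; refl; sym; trans; cong; subst; subst₂; module ≡-Reasoning)
open import Relation.Nullary using (¬_; Dec; yes; no; ¬?; _×-dec_; _⊎-dec_)
open import Relation.Nullary.Decidable using (⌊_⌋; toWitness; fromWitness; decidable-stable; map′)

Opposite : Sgn → Sgn → Set
Opposite s t = (s ≡ +ₛ × t ≡ -ₛ) ⊎ (s ≡ -ₛ × t ≡ +ₛ)

opposite? : ∀ s t → Dec (Opposite s t)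
opposite? s t = ((s ≟ₛ +ₛ) ×-dec (t ≟ₛ -ₛ)) ⊎-dec ((s ≟ₛ -ₛ) ×-dec (t ≟ₛ +ₛ))

≡⇒¬opposite : ∀ {s t} → s ≡ t → ¬ Opposite s t
≡⇒¬opposite refl (inj₁ (refl , ()))
≡⇒¬opposite refl (inj₂ (refl , ()))

¬opposite-0ˡ : ∀ {t} → ¬ Opposite 0ₛ t
¬opposite-0ˡ (inj₁ (() , _))
¬opposite-0ˡ (inj₂ (() , _))

¬opposite-0ʳ : ∀ {s} → ¬ Opposite s 0ₛ
¬opposite-0ʳ (inj₁ (_ , ()))
¬opposite-0ʳ (inj₂ (_ , ()))

opposite⇒≢0ʳ : ∀ {s t} → Opposite s t → t ≢ 0ₛ
opposite⇒≢0ʳ o refl = ¬opposite-0ʳ o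

opposite-negₛʳ : ∀ {s} → s ≢ 0ₛ → Opposite s (negₛ s)
opposite-negₛʳ {0ₛ} s≢0 = ⊥-elim (s≢0 refl)
opposite-negₛʳ {+ₛ} _ = inj₁ (refl , refl)
opposite-negₛʳ { -ₛ} _ = inj₂ (refl , refl)

opposite-negₛˡ : ∀ {s} → s ≢ 0ₛ → Opposite (negₛ s) s
opposite-negₛˡ {0ₛ} s≢0 = ⊥-elim (s≢0 refl)
opposite-negₛˡ {+ₛ} _ = inj₂ (refl , refl)
opposite-negₛˡ { -ₛ} _ = inj₁ (refl , refl)

negₛ-zero⁻ : ∀ {s} → negₛ s ≡ 0ₛ → s ≡ 0ₛ
negₛ-zero⁻ {0ₛ} _ = refl

nonzero⇒≡-or-negₛ≡ : ∀ {s t} → s ≢ 0ₛ → t ≢ 0ₛ → s ≡ t ⊎ negₛ s ≡ t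
nonzero⇒≡-or-negₛ≡ {0ₛ} s≢0 _ = ⊥-elim (s≢0 refl)
nonzero⇒≡-or-negₛ≡ {_} {0ₛ} _ t≢0 = ⊥-elim (t≢0 refl)
nonzero⇒≡-or-negₛ≡ {+ₛ} {+ₛ} _ _ = inj₁ refl
nonzero⇒≡-or-negₛ≡ {+ₛ} { -ₛ} _ _ = inj₂ refl
nonzero⇒≡-or-negₛ≡ { -ₛ} {+ₛ} _ _ = inj₂ refl
nonzero⇒≡-or-negₛ≡ { -ₛ} { -ₛ} _ _ = inj₁ refl

compₛ-nonzero : ∀ {s} t → s ≢ 0ₛ → compₛ s t ≡ s
compₛ-nonzero {0ₛ} _ s≢0 = ⊥-elim (s≢0 refl)
compₛ-nonzero {+ₛ} _ _ = refl
compₛ-nonzero { -ₛ} _ _ = refl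

compₛ-zero : ∀ {s t} → s ≡ 0ₛ → t ≡ 0ₛ → compₛ s t ≡ 0ₛ
compₛ-zero refl refl = refl

compₛ-identityʳ : ∀ s → compₛ s 0ₛ ≡ s
compₛ-identityʳ 0ₛ = refl
compₛ-identityʳ +ₛ = refl
compₛ-identityʳ -ₛ = refl

compₛ-zeroˡ : ∀ s t → compₛ s t ≡ 0ₛ → s ≡ 0ₛ
compₛ-zeroˡ 0ₛ _ _ = refl

compₛ-zeroʳ : ∀ s t → compₛ s t ≡ 0ₛ → t ≡ 0ₛ
compₛ-zeroʳ 0ₛ _ st≡0 = st≡0

compₛ-≡ : ∀ {s t} → s ≡ t → compₛ s t ≡ t
compₛ-≡ {0ₛ} refl = refl
compₛ-≡ {+ₛ} refl = refl
compₛ-≡ { -ₛ} refl = refl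

compₛ-¬opposite : ∀ s t → ¬ Opposite s t → ¬ Opposite (compₛ s t) t
compₛ-¬opposite 0ₛ _ _ = ≡⇒¬opposite refl
compₛ-¬opposite +ₛ _ ¬o = ¬o
compₛ-¬opposite -ₛ _ ¬o = ¬o

≤ₛ-zero : ∀ {s t} → s ≤ₛ t → t ≡ 0ₛ → s ≡ 0ₛ
≤ₛ-zero 0≤ _ = refl
≤ₛ-zero refl≤ t≡0 = t≡0

≤ₛ-nonzero : ∀ {s t} → s ≤ₛ t → s ≢ 0ₛ → s ≡ t
≤ₛ-nonzero 0≤ s≢0 = ⊥-elim (s≢0 refl)
≤ₛ-nonzero refl≤ _ = refl

≤ₛ-trans : ∀ {s t u} → s ≤ₛ t → t ≤ₛ u → s ≤ₛ u
≤ₛ-trans 0≤ _ = 0≤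
≤ₛ-trans refl≤ t≤u = t≤u

≤ₛ-compₛ : ∀ s t → s ≤ₛ compₛ s t
≤ₛ-compₛ 0ₛ _ = 0≤
≤ₛ-compₛ +ₛ _ = refl≤
≤ₛ-compₛ -ₛ _ = refl≤

¬opposite⇒≤ₛ : ∀ s t → ¬ Opposite s t → (t ≡ 0ₛ → s ≡ 0ₛ) → s ≤ₛ t
¬opposite⇒≤ₛ 0ₛ _ _ _ = 0≤
¬opposite⇒≤ₛ +ₛ 0ₛ _ zero⇒ with () ← zero⇒ refl
¬opposite⇒≤ₛ +ₛ +ₛ _ _ = refl≤
¬opposite⇒≤ₛ +ₛ -ₛ ¬o _ = ⊥-elim (¬o (inj₁ (refl , refl)))
¬opposite⇒≤ₛ -ₛ 0ₛ _ zero⇒ with () ← zero⇒ refl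
¬opposite⇒≤ₛ -ₛ +ₛ ¬o _ = ⊥-elim (¬o (inj₂ (refl , refl)))
¬opposite⇒≤ₛ -ₛ -ₛ _ _ = refl≤

infix 30 _⟨_⟩
_⟨_⟩ : ∀ {n} → SignVec n → Fin n → Sgn
X ⟨ g ⟩ = lookup X g

module _ {n : ℕ} where

  lookup-ext : (X Y : SignVec n) → (∀ g → X ⟨ g ⟩ ≡ Y ⟨ g ⟩) → X ≡ Y
  lookup-ext X Y X≗Y = trans (sym (tabulate∘lookup X)) (trans (tabulate-cong X≗Y) (tabulate∘lookup Y))

  ∘ᵥ-lookup : ∀ (X Y : SignVec n) g → (X ∘ᵥ Y) ⟨ g ⟩ ≡ compₛ (X ⟨ g ⟩) (Y ⟨ g ⟩)
  ∘ᵥ-lookup X Y g = lookup-zipWith compₛ g X Y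

  neg-lookup : ∀ (X : SignVec n) g → neg X ⟨ g ⟩ ≡ negₛ (X ⟨ g ⟩)
  neg-lookup X g = lookup-map g negₛ X

  infix 4 _≼_ _⊆₀_ _⊂₀_

  _≼_ : SignVec n → SignVec n → Set
  X ≼ Y = ∀ g → X ⟨ g ⟩ ≤ₛ Y ⟨ g ⟩

  Conformal : SignVec n → SignVec n → Set
  Conformal X Y = ∀ g → ¬ Opposite (X ⟨ g ⟩) (Y ⟨ g ⟩)

  _⊆₀_ : SignVec n → SignVec n → Set
  X ⊆₀ Y = ∀ g → X ⟨ g ⟩ ≡ 0ₛ → Y ⟨ g ⟩ ≡ 0ₛ

  ExtraZero : SignVec n → SignVec n → Set
  ExtraZero Y X = ∃ λ g → X ⟨ g ⟩ ≢ 0ₛ × Y ⟨ g ⟩ ≡ 0ₛ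

  Differ : SignVec n → SignVec n → Set
  Differ Y Y′ = ExtraZero Y Y′ ⊎ ExtraZero Y′ Y

  extraZero? : ∀ Y X → Dec (ExtraZero Y X)
  extraZero? Y X = Fin.any? λ g → ¬? (X ⟨ g ⟩ ≟ₛ 0ₛ) ×-dec (Y ⟨ g ⟩ ≟ₛ 0ₛ)

  differ? : ∀ Y Y′ → Dec (Differ Y Y′)
  differ? Y Y′ = extraZero? Y Y′ ⊎-dec extraZero? Y′ Y

  _⊂₀_ : SignVec n → SignVec n → Set
  X ⊂₀ Y = X ⊆₀ Y × ExtraZero Y X

  ∘ᵥ-⊆₀ˡ : ∀ X Y → X ∘ᵥ Y ⊆₀ X
  ∘ᵥ-⊆₀ˡ X Y g XY≡0 = compₛ-zeroˡ _ _ (trans (sym (∘ᵥ-lookup X Y g)) XY≡0)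

  ∘ᵥ-⊂₀ˡ : ∀ X Y → ExtraZero X Y → X ∘ᵥ Y ⊂₀ X
  ∘ᵥ-⊂₀ˡ X Y (g , Y≢0 , X≡0) = ∘ᵥ-⊆₀ˡ X Y , g ,
    (λ XY≡0 → Y≢0 (compₛ-zeroʳ _ _ (trans (sym (∘ᵥ-lookup X Y g)) XY≡0))) , X≡0

  ⊂₀-∘ᵥ : ∀ W X Y → W ⊆₀ X → W ⊆₀ Y → (∃ λ g → W ⟨ g ⟩ ≢ 0ₛ × X ⟨ g ⟩ ≡ 0ₛ × Y ⟨ g ⟩ ≡ 0ₛ) →
    W ⊂₀ X ∘ᵥ Y
  ⊂₀-∘ᵥ W X Y W⊆X W⊆Y (g , W≢0 , X≡0 , Y≡0) =
    (λ h W≡0 → trans (∘ᵥ-lookup X Y h) (compₛ-zero (W⊆X h W≡0) (W⊆Y h W≡0))) ,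
    g , W≢0 , trans (∘ᵥ-lookup X Y g) (compₛ-zero X≡0 Y≡0)

  separation : SignVec n → SignVec n → Subset n
  separation X Y = tabulate λ g → ⌊ opposite? (X ⟨ g ⟩) (Y ⟨ g ⟩) ⌋

  ∈-separation⁺ : ∀ {X Y g} → Opposite (X ⟨ g ⟩) (Y ⟨ g ⟩) → g ∈ₛ separation X Y
  ∈-separation⁺ {X} {Y} {g} o = lookup⇒[]= g _ (trans (lookup∘tabulate _ g) (Equivalence.to T-≡ (fromWitness o)))

  ∈-separation⁻ : ∀ {X Y g} → g ∈ₛ separation X Y → Opposite (X ⟨ g ⟩) (Y ⟨ g ⟩)
  ∈-separation⁻ {X} {Y} {g} g∈ =
    toWitness {a? = opposite? (X ⟨ g ⟩) (Y ⟨ g ⟩)}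
              (Equivalence.from T-≡ (trans (sym (lookup∘tabulate _ g)) ([]=⇒lookup g∈)))

  separation-shrinks : ∀ {Z W Z₁ : SignVec n} {f} → Opposite (Z ⟨ f ⟩) (W ⟨ f ⟩) → Z₁ ⟨ f ⟩ ≡ 0ₛ →
    (∀ g → ¬ Opposite (Z ⟨ g ⟩) (W ⟨ g ⟩) → Z₁ ⟨ g ⟩ ≡ compₛ (Z ⟨ g ⟩) (W ⟨ g ⟩)) →
    separation Z₁ W ⊂ₛ separation Z W
  separation-shrinks {Z} {W} {Z₁} {f} o Z₁f≡0 Z₁≡ =
    (λ {g} g∈ → stays g (∈-separation⁻ {Z₁} {W} g∈)) , f , ∈-separation⁺ {Z} {W} o ,
    (λ f∈ → ¬opposite-0ˡ (subst (λ s → Opposite s _) Z₁f≡0 (∈-separation⁻ {Z₁} {W} f∈)))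
    where
    stays : ∀ g → Opposite (Z₁ ⟨ g ⟩) (W ⟨ g ⟩) → g ∈ₛ separation Z W
    stays g o₁ with opposite? (Z ⟨ g ⟩) (W ⟨ g ⟩)
    ... | yes oᵍ = ∈-separation⁺ {Z} {W} oᵍ
    ... | no ¬oᵍ = ⊥-elim (compₛ-¬opposite _ _ ¬oᵍ (subst (λ s → Opposite s _) (Z₁≡ g ¬oᵍ) o₁))

module _ {A : Set} where

  unique-⊆⇒length≤ : ∀ {xs ys : List A} → Unique xs → xs ⊆ ys → length xs ≤ length ys
  unique-⊆⇒length≤ {[]} _ _ = z≤n
  unique-⊆⇒length≤ {x ∷ xs} {ys} (x∉xs ∷ unique) xs⊆ys with as , bs , refl ← ∈-∃++ (xs⊆ys (here refl)) =
    ≤-trans (s≤s (unique-⊆⇒length≤ unique xs⊆as++bs)) (≤-reflexive (sym (length-++-sucʳ as x bs)))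
    where
    xs⊆as++bs : xs ⊆ as ++ bs
    xs⊆as++bs {z} z∈xs with ∈-++⁻ as (xs⊆ys (there z∈xs))
    ... | inj₁ z∈as = ∈-++⁺ˡ z∈as
    ... | inj₂ (here refl) = ⊥-elim (All.lookup x∉xs z∈xs refl)
    ... | inj₂ (there z∈bs) = ∈-++⁺ʳ as z∈bs

  length-unique-pair : ∀ {l : List A} {a b} → Unique l → a ≢ b → a ∈ l → b ∈ l →
    (∀ {x} → x ∈ l → x ≡ a ⊎ x ≡ b) → length l ≡ 2
  length-unique-pair {l} {a} {b} unique a≢b a∈l b∈l only = ≤-antisym
    (unique-⊆⇒length≤ {ys = a ∷ b ∷ []} unique
       λ x∈l → [ (λ { refl → here refl }) , (λ { refl → there (here refl) }) ]′ (only x∈l))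
    (unique-⊆⇒length≤ ((a≢b ∷ []) ∷ [] ∷ []) λ { (here refl) → a∈l ; (there (here refl)) → b∈l })

module _ {A : Set} {R : A → A → Set} where

  linked-∷ : ∀ {x xs} → All (R x) xs → Linked R xs → Linked R (x ∷ xs)
  linked-∷ [] _ = [-]
  linked-∷ (Rxy ∷ _) linked = Rxy ∷ linked

  linked-∷ʳ : ∀ {xs y} → Linked R xs → All (λ x → R x y) xs → Linked R (xs ∷ʳ y)
  linked-∷ʳ [] [] = [-]
  linked-∷ʳ [-] (Rxy ∷ []) = Rxy ∷ [-]
  linked-∷ʳ (Rxz ∷ linked) (_ ∷ R-y) = Rxz ∷ linked-∷ʳ linked R-y

record ExactlyTwo {A : Set} (P : A → Set) : Set where
  field
    first second : A
    first≢second : first ≢ second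
    first-P : P first
    second-P : P second
    only : ∀ {x} → P x → x ≡ first ⊎ x ≡ second

module _ {A : Set} (_≟_ : DecidableEquality A) where

  unique-⊆-length≥⇒⊇ : ∀ {xs ys : List A} → Unique xs → xs ⊆ ys → length ys ≤ length xs → ys ⊆ xs
  unique-⊆-length≥⇒⊇ {xs} {ys} unique xs⊆ys ys≤xs {y} y∈ys with y ∈L? xs
    where open import Data.List.Membership.DecPropositional _≟_ renaming (_∈?_ to _∈L?_)
  ... | yes y∈xs = y∈xs
  ... | no y∉xs = ⊥-elim (<⇒≱ (s≤s ≤-refl)
      (≤-trans (unique-⊆⇒length≤ (All.tabulate (λ z∈xs y≡z → y∉xs (subst (_∈ xs) (sym y≡z) z∈xs)) ∷ unique)
                                  λ { (here refl) → y∈ys ; (there z∈xs) → xs⊆ys z∈xs })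
               ys≤xs))

module StrictChains {A : Set} {_<_ : A → A → Set}
                    (<-trans : Transitive _<_) (<-irrefl : Irreflexive _≡_ _<_) (_<?_ : Decidable _<_) where

  Comparable : A → A → Set
  Comparable x y = y < x ⊎ x < y

  insert : A → List A → List A
  insert x [] = x ∷ []
  insert x (y ∷ ys) with y <? x
  ... | yes _ = y ∷ insert x ys
  ... | no _ = x ∷ y ∷ ys

  ∈-insert⁻ : ∀ x ys {z} → z ∈ insert x ys → z ≡ x ⊎ z ∈ ys
  ∈-insert⁻ x [] (here refl) = inj₁ refl
  ∈-insert⁻ x (y ∷ ys) z∈ with y <? x | z∈
  ... | yes _ | here refl = inj₂ (here refl)
  ... | yes _ | there z∈′ = Sum.map₂ there (∈-insert⁻ x ys z∈′)
  ... | no _ | here refl = inj₁ refl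
  ... | no _ | there z∈ys = inj₂ z∈ys

  All-insert : ∀ {P : A → Set} {x ys} → P x → All P ys → All P (insert x ys)
  All-insert {x = x} {ys} Px Pys = All.tabulate λ z∈ → [ (λ { refl → Px }) , All.lookup Pys ]′ (∈-insert⁻ x ys z∈)

  ∈-insert : ∀ x ys → x ∈ insert x ys
  ∈-insert x [] = here refl
  ∈-insert x (y ∷ ys) with y <? x
  ... | yes _ = there (∈-insert x ys)
  ... | no _ = here refl

  insert-⊇ : ∀ x ys → ys ⊆ insert x ys
  insert-⊇ x (y ∷ ys) z∈ with y <? x | z∈
  ... | yes _ | here refl = here refl
  ... | yes _ | there z∈ys = there (insert-⊇ x ys z∈ys)
  ... | no _ | _ = there z∈

  length-insert : ∀ x ys → length (insert x ys) ≡ suc (length ys)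
  length-insert x [] = refl
  length-insert x (y ∷ ys) with y <? x
  ... | yes _ = cong suc (length-insert x ys)
  ... | no _ = refl

  insert-linked-above : ∀ x z ys → z < x → Linked _<_ (z ∷ ys) → All (Comparable x) ys → Linked _<_ (z ∷ insert x ys)
  insert-linked-above x z [] z<x _ _ = z<x ∷ [-]
  insert-linked-above x z (y ∷ ys) z<x (z<y ∷ linked) (cmp ∷ cmps) with y <? x | cmp
  ... | yes y<x | _ = z<y ∷ insert-linked-above x y ys y<x linked cmps
  ... | no y≮x | inj₁ y<x = ⊥-elim (y≮x y<x)
  ... | no _ | inj₂ x<y = z<x ∷ x<y ∷ linked

  insert-linked : ∀ x ys → Linked _<_ ys → All (Comparable x) ys → Linked _<_ (insert x ys)
  insert-linked x [] _ _ = [-]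
  insert-linked x (y ∷ ys) linked (cmp ∷ cmps) with y <? x | cmp
  ... | yes y<x | _ = insert-linked-above x y ys y<x linked cmps
  ... | no y≮x | inj₁ y<x = ⊥-elim (y≮x y<x)
  ... | no _ | inj₂ x<y = x<y ∷ linked

  linked⇒unique : ∀ {xs} → Linked _<_ xs → Unique xs
  linked⇒unique linked = AllPairs.map (λ x<y x≡y → <-irrefl x≡y x<y) (Linked⇒AllPairs <-trans linked)

  allPairs-comparable : ∀ {xs x y} → AllPairs _<_ xs → x ∈ xs → y ∈ xs → x ≢ y → x < y ⊎ y < x
  allPairs-comparable (_ ∷ _) (here refl) (here refl) x≢y = ⊥-elim (x≢y refl)
  allPairs-comparable (x< ∷ _) (here refl) (there y∈) _ = inj₁ (All.lookup x< y∈)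
  allPairs-comparable (y< ∷ _) (there x∈) (here refl) _ = inj₂ (All.lookup y< x∈)
  allPairs-comparable (_ ∷ sorted) (there x∈) (there y∈) x≢y = allPairs-comparable sorted x∈ y∈ x≢y

  allPairs-≡ : ∀ {xs ys} → AllPairs _<_ xs → AllPairs _<_ ys → xs ⊆ ys → ys ⊆ xs → xs ≡ ys
  allPairs-≡ {[]} {[]} _ _ _ _ = refl
  allPairs-≡ {[]} {y ∷ ys} _ _ _ ys⊆xs with () ← ys⊆xs (here refl)
  allPairs-≡ {x ∷ xs} {[]} _ _ xs⊆ys _ with () ← xs⊆ys (here refl)
  allPairs-≡ {x ∷ xs} {y ∷ ys} (x< ∷ sortedˣ) (y< ∷ sortedʸ) xs⊆ys ys⊆xs
    with xs⊆ys (here refl) | ys⊆xs (here refl)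
  ... | here refl | _ =
    cong (x ∷_) (allPairs-≡ sortedˣ sortedʸ (tail-⊆ x< (xs⊆ys ∘ there)) (tail-⊆ y< (ys⊆xs ∘ there)))
    where
    tail-⊆ : ∀ {u us vs} → All (u <_) us → us ⊆ u ∷ vs → us ⊆ vs
    tail-⊆ u< us⊆ z∈ with us⊆ z∈
    ... | here refl = ⊥-elim (<-irrefl refl (All.lookup u< z∈))
    ... | there z∈vs = z∈vs
  ... | there x∈ys | here refl = ⊥-elim (<-irrefl refl (All.lookup y< x∈ys))
  ... | there x∈ys | there y∈xs = ⊥-elim (<-irrefl refl (<-trans (All.lookup y< x∈ys) (All.lookup x< y∈xs)))

_≟ˢ_ : ∀ {n} → DecidableEquality (Subset n)
_≟ˢ_ = ≡-dec _≟ᵇ_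

⊆∧⊉⇒⊂ : ∀ {n} {A B : Subset n} → A ⊆ₛ B → ¬ (B ⊆ₛ A) → A ⊂ₛ B
⊆∧⊉⇒⊂ {A = A} {B} A⊆B B⊈A with Fin.any? (λ x → (x ∈? B) ×-dec ¬? (x ∈? A))
... | yes (x , x∈B , x∉A) = A⊆B , x , x∈B , x∉A
... | no none = ⊥-elim (B⊈A λ {x} x∈B → decidable-stable (x ∈? A) λ x∉A → none (x , x∈B , x∉A))

∪⁅⁆-least : ∀ {n} {h K : Subset n} {e} → h ⊆ₛ K → e ∈ₛ K → h ∪ ⁅ e ⁆ ⊆ₛ K
∪⁅⁆-least {h = h} {e = e} h⊆K e∈K x∈ with x∈p∪q⁻ h ⁅ e ⁆ x∈
... | inj₁ x∈h = h⊆K x∈h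
... | inj₂ x∈⁅e⁆ rewrite x∈⁅y⁆⇒x≡y e x∈⁅e⁆ = e∈K

linked-head-below : ∀ {n} {h : Subset n} {hs} → Linked _⊂ₛ_ (h ∷ hs) → All (h ⊂ₛ_) hs
linked-head-below linked = AllPairs.head (Linked⇒AllPairs ⊂-trans linked)

lower-head : ∀ {n} {h h′ : Subset n} {hs} → h ⊆ₛ h′ → Linked _⊂ₛ_ (h′ ∷ hs) → Linked _⊂ₛ_ (h ∷ hs)
lower-head _ [-] = [-]
lower-head h⊆h′ (h′⊂ ∷ linked) = ⊆-⊂-trans h⊆h′ h′⊂ ∷ linked

-- Covector elimination

module Covectors {n : ℕ} (𝓜 : OrientedMatroid n) where

  𝓒 : List (SignVec n)
  𝓒 = covectors 𝓜

  record Eliminant (X Y : SignVec n) (e : Fin n) (Z : SignVec n) : Set where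
    field
      member : Z ∈ 𝓒
      vanishes : Z ⟨ e ⟩ ≡ 0ₛ
      composes : ∀ f → ¬ Opposite (X ⟨ f ⟩) (Y ⟨ f ⟩) → Z ⟨ f ⟩ ≡ compₛ (X ⟨ f ⟩) (Y ⟨ f ⟩)

    at-zeroˡ : ∀ {f} → X ⟨ f ⟩ ≡ 0ₛ → Z ⟨ f ⟩ ≡ Y ⟨ f ⟩
    at-zeroˡ {f} Xf≡0 =
      trans (composes f (λ o → ¬opposite-0ˡ (subst (λ s → Opposite s _) Xf≡0 o))) (cong (λ s → compₛ s _) Xf≡0)

    at-zeroʳ : ∀ {f} → Y ⟨ f ⟩ ≡ 0ₛ → Z ⟨ f ⟩ ≡ X ⟨ f ⟩
    at-zeroʳ {f} Yf≡0 =
      trans (composes f (λ o → ¬opposite-0ʳ (subst (Opposite _) Yf≡0 o)))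
            (trans (cong (compₛ _) Yf≡0) (compₛ-identityʳ _))

    at-agreement : ∀ {f} → X ⟨ f ⟩ ≡ Y ⟨ f ⟩ → Z ⟨ f ⟩ ≡ Y ⟨ f ⟩
    at-agreement {f} Xf≡Yf = trans (composes f (≡⇒¬opposite Xf≡Yf)) (compₛ-≡ Xf≡Yf)

  open Eliminant public

  eliminate : ∀ {X Y} → X ∈ 𝓒 → Y ∈ 𝓒 → ∀ e → Opposite (X ⟨ e ⟩) (Y ⟨ e ⟩) → ∃ (Eliminant X Y e)
  eliminate {X} {Y} X∈ Y∈ e o with Z , Z∈ , Ze≡0 , Z≡ ← V3 𝓜 X Y X∈ Y∈ e o =
    Z , record { member = Z∈ ; vanishes = Ze≡0 ; composes = λ f ¬o → trans (Z≡ f ¬o) (∘ᵥ-lookup X Y f) }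

  ConformalRefinement : SignVec n → SignVec n → SignVec n → Set
  ConformalRefinement Z W Z′ =
    Z′ ∈ 𝓒 × Conformal Z′ W × (∀ g → Z ⟨ g ⟩ ≡ W ⟨ g ⟩ → Z′ ⟨ g ⟩ ≡ W ⟨ g ⟩) × (ExtraZero Z W → ExtraZero Z′ W)

  conform-toward : ∀ {Z W} → Z ∈ 𝓒 → W ∈ 𝓒 → ∃ (ConformalRefinement Z W)
  conform-toward {Z} {W} Z∈ W∈ = go Z∈ (⊂-wellFounded (separation Z W))
    where
    go : ∀ {Z} → Z ∈ 𝓒 → Acc _⊂ₛ_ (separation Z W) → ∃ (ConformalRefinement Z W)
    go {Z} Z∈ (acc smaller) with Fin.any? (λ g → opposite? (Z ⟨ g ⟩) (W ⟨ g ⟩))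
    ... | no none = Z , Z∈ , (λ g o → none (g , o)) , (λ _ agree → agree) , id
    ... | yes (f , o)
      with Z₁ , Z₁-elim ← eliminate Z∈ W∈ f o
      with Z′ , Z′∈ , conformal , keeps , extra
             ← go (member Z₁-elim)
                  (smaller (separation-shrinks {Z = Z} {W = W} {Z₁ = Z₁} o (vanishes Z₁-elim) (composes Z₁-elim)))
      = Z′ , Z′∈ , conformal ,
        (λ g agree → keeps g (at-agreement Z₁-elim agree)) ,
        (λ _ → extra (f , opposite⇒≢0ʳ o , vanishes Z₁-elim))

  sign-adjusted : ∀ {Y e s} → Y ∈ 𝓒 → Y ⟨ e ⟩ ≢ 0ₛ → s ≢ 0ₛ →
    ∃ λ Y′ → Y′ ∈ 𝓒 × Y′ ⟨ e ⟩ ≡ s × Y′ ⊆₀ Y × Y ⊆₀ Y′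
  sign-adjusted {Y} {e} Y∈ Y≢0 s≢0 with nonzero⇒≡-or-negₛ≡ Y≢0 s≢0
  ... | inj₁ Y≡s = Y , Y∈ , Y≡s , (λ _ → id) , (λ _ → id)
  ... | inj₂ -Y≡s = neg Y , V1 𝓜 Y Y∈ , trans (neg-lookup Y e) -Y≡s ,
                    (λ g -Y≡0 → negₛ-zero⁻ (trans (sym (neg-lookup Y g)) -Y≡0)) ,
                    (λ g Y≡0 → trans (neg-lookup Y g) (cong negₛ Y≡0))

  module Interval {X W : SignVec n} (X∈ : X ∈ 𝓒) (W∈ : W ∈ 𝓒) (X≼W : X ≼ W) where

    -- With X = T ∖ B and W = T ∖ A, the zero sets of such Y are the flats strictly between A and B.
    record Between (Y : SignVec n) : Set where
      field
        covector : Y ∈ 𝓒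
        above : X ≼ Y
        below : Y ≼ W
        extraZero : ExtraZero Y W
        extraSupport : ExtraZero X Y

      W⊆₀ : W ⊆₀ Y
      W⊆₀ g = ≤ₛ-zero (below g)

      ⊆₀X : Y ⊆₀ X
      ⊆₀X g = ≤ₛ-zero (above g)

      W⊂₀ : W ⊂₀ Y
      W⊂₀ = W⊆₀ , extraZero

      ⊂₀X : Y ⊂₀ X
      ⊂₀X = ⊆₀X , extraSupport

    open Between public

    IntervalRank≤2 : Set
    IntervalRank≤2 = ∀ U U′ → U ∈ 𝓒 → U′ ∈ 𝓒 → W ⊂₀ U → U ⊂₀ U′ → U′ ⊂₀ X → ⊥

    X∘-_ : SignVec n → SignVec n
    X∘- Y = X ∘ᵥ neg Y

    X∘-∈ : ∀ {Y} → Y ∈ 𝓒 → X∘- Y ∈ 𝓒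
    X∘-∈ {Y} Y∈ = V2 𝓜 X (neg Y) X∈ (V1 𝓜 Y Y∈)

    X∘-lookup : ∀ Y g → (X∘- Y) ⟨ g ⟩ ≡ compₛ (X ⟨ g ⟩) (negₛ (Y ⟨ g ⟩))
    X∘-lookup Y g = trans (∘ᵥ-lookup X (neg Y) g) (cong (compₛ _) (neg-lookup Y g))

    X∘-on-support : ∀ Y {g} → X ⟨ g ⟩ ≢ 0ₛ → (X∘- Y) ⟨ g ⟩ ≡ X ⟨ g ⟩
    X∘-on-support Y X≢0 = trans (X∘-lookup Y _) (compₛ-nonzero _ X≢0)

    X∘-off-support : ∀ Y {g} → X ⟨ g ⟩ ≡ 0ₛ → (X∘- Y) ⟨ g ⟩ ≡ negₛ (Y ⟨ g ⟩)
    X∘-off-support Y X≡0 = trans (X∘-lookup Y _) (cong (λ s → compₛ s _) X≡0)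

    W⊆₀X∘- : ∀ {Y} → W ⊆₀ Y → W ⊆₀ X∘- Y
    W⊆₀X∘- {Y} W⊆Y g Wg≡0 = trans (X∘-lookup Y g) (compₛ-zero (≤ₛ-zero (X≼W g) Wg≡0) (cong negₛ (W⊆Y g Wg≡0)))

    X∘ᵥ-≡W-on-support : ∀ Y g → X ⟨ g ⟩ ≢ 0ₛ → (X ∘ᵥ Y) ⟨ g ⟩ ≡ W ⟨ g ⟩
    X∘ᵥ-≡W-on-support Y g Xg≢0 =
      trans (∘ᵥ-lookup X Y g) (trans (compₛ-nonzero _ Xg≢0) (≤ₛ-nonzero (X≼W g) Xg≢0))

    between-from : ∀ {U} → U ∈ 𝓒 → (∀ g → X ⟨ g ⟩ ≢ 0ₛ → U ⟨ g ⟩ ≡ W ⟨ g ⟩) → W ⊂₀ U →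
      ∀ {g} → X ⟨ g ⟩ ≡ 0ₛ → W ⟨ g ⟩ ≢ 0ₛ → U ⟨ g ⟩ ≡ W ⟨ g ⟩ → ∃ λ Y → Between Y × Y ⟨ g ⟩ ≢ 0ₛ
    between-from U∈ U≡W (W⊆U , extra) {g} Xg≡0 Wg≢0 Ug≡Wg
      with Y , Y∈ , conformal , keeps , extra′ ← conform-toward U∈ W∈ =
      Y , record { covector = Y∈ ; above = X≼Y ; below = Y≼W ; extraZero = extra′ extra
                 ; extraSupport = g , Yg≢0 , Xg≡0 } , Yg≢0
      where
      Yg≢0 : Y ⟨ g ⟩ ≢ 0ₛ
      Yg≢0 Yg≡0 = Wg≢0 (trans (sym (keeps g Ug≡Wg)) Yg≡0)
      X≼Y : X ≼ Y
      X≼Y h with X ⟨ h ⟩ ≟ₛ 0ₛ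
      ... | yes Xh≡0 = subst (_≤ₛ Y ⟨ h ⟩) (sym Xh≡0) 0≤
      ... | no Xh≢0 = subst (X ⟨ h ⟩ ≤ₛ_) (trans (≤ₛ-nonzero (X≼W h) Xh≢0) (sym (keeps h (U≡W h Xh≢0)))) refl≤
      Y≼W : Y ≼ W
      Y≼W h = ¬opposite⇒≤ₛ _ _ (conformal h) λ Wh≡0 → trans (keeps h (trans (W⊆U h Wh≡0) (sym Wh≡0))) Wh≡0

    between-of : ∀ {V} → V ∈ 𝓒 → W ⊂₀ V → V ⊂₀ X → ∃ Between
    between-of V∈ (W⊆V , g₁ , Wg₁≢0 , Vg₁≡0) (V⊆X , g₀ , Vg₀≢0 , Xg₀≡0)
      with V′ , V′∈ , V′g₀≡Wg₀ , _ , V⊆V′ ← sign-adjusted V∈ Vg₀≢0 (Vg₀≢0 ∘ W⊆V g₀)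
      with Y , between , _
             ← between-from (V2 𝓜 X V′ X∈ V′∈) (X∘ᵥ-≡W-on-support V′)
                 (⊂₀-∘ᵥ W X V′ (λ h → ≤ₛ-zero (X≼W h)) (λ h → V⊆V′ h ∘ W⊆V h)
                        (g₁ , Wg₁≢0 , V⊆X g₁ Vg₁≡0 , V⊆V′ g₁ Vg₁≡0))
                 Xg₀≡0 (Vg₀≢0 ∘ W⊆V g₀)
                 (trans (∘ᵥ-lookup X V′ g₀) (trans (cong (λ s → compₛ s _) Xg₀≡0) V′g₀≡Wg₀))
      = Y , between

    another-between : ∀ {Y₁} → Between Y₁ → ∃ λ Y₂ → Between Y₂ × ExtraZero Y₁ Y₂
    another-between {Y₁} b₁ with e , Y₁e≢0 , Xe≡0 ← extraSupport b₁ | p , Wp≢0 , Y₁p≡0 ← extraZero b₁ =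
      second (eliminate W∈ (X∘-∈ (covector b₁)) e
               (subst₂ Opposite (≤ₛ-nonzero (below b₁ e) Y₁e≢0) (sym (X∘-off-support Y₁ Xe≡0))
                       (opposite-negₛʳ Y₁e≢0)))
      where
      Xp≡0 : X ⟨ p ⟩ ≡ 0ₛ
      Xp≡0 = ⊆₀X b₁ p Y₁p≡0
      second : ∃ (Eliminant W (X∘- Y₁) e) → ∃ λ Y₂ → Between Y₂ × ExtraZero Y₁ Y₂
      second (Z , Z-elim) =
        let Y₂ , b₂ , Y₂p≢0 =
              between-from (member Z-elim) onSupport (W⊆Z , e , Y₁e≢0 ∘ W⊆₀ b₁ e , vanishes Z-elim)
                Xp≡0 Wp≢0 (at-zeroʳ Z-elim (trans (X∘-off-support Y₁ Xp≡0) (cong negₛ Y₁p≡0)))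
        in Y₂ , b₂ , p , Y₂p≢0 , Y₁p≡0
        where
        onSupport : ∀ g → X ⟨ g ⟩ ≢ 0ₛ → Z ⟨ g ⟩ ≡ W ⟨ g ⟩
        onSupport g Xg≢0 = trans (at-agreement Z-elim (sym X∘-Y₁≡W)) X∘-Y₁≡W
          where
          X∘-Y₁≡W : (X∘- Y₁) ⟨ g ⟩ ≡ W ⟨ g ⟩
          X∘-Y₁≡W = X∘ᵥ-≡W-on-support (neg Y₁) g Xg≢0
        W⊆Z : W ⊆₀ Z
        W⊆Z g Wg≡0 = trans (at-zeroˡ Z-elim Wg≡0) (W⊆₀X∘- (W⊆₀ b₁) g Wg≡0)

    module _ (rank : IntervalRank≤2) where

      no-between-above : ∀ {U Y} → U ∈ 𝓒 → Between Y → W ⊂₀ U → U ⊂₀ Y → ⊥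
      no-between-above U∈ b W⊂U U⊂Y = rank _ _ U∈ (covector b) W⊂U U⊂Y (⊂₀X b)

      no-between-below : ∀ {U Y} → U ∈ 𝓒 → Between Y → Y ⊂₀ U → U ⊂₀ X → ⊥
      no-between-below U∈ b Y⊂U U⊂X = rank _ _ (covector b) U∈ (W⊂₀ b) Y⊂U U⊂X

      common-zero⇒W-zero : ∀ {Y Y′} → Between Y → Between Y′ → ExtraZero Y Y′ →
        ∀ g → Y ⟨ g ⟩ ≡ 0ₛ → Y′ ⟨ g ⟩ ≡ 0ₛ → W ⟨ g ⟩ ≡ 0ₛ
      common-zero⇒W-zero {Y} {Y′} b b′ extra g Yg≡0 Y′g≡0 with W ⟨ g ⟩ ≟ₛ 0ₛ
      ... | yes Wg≡0 = Wg≡0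
      ... | no Wg≢0 = ⊥-elim (no-between-above (V2 𝓜 Y Y′ (covector b) (covector b′)) b
                                (⊂₀-∘ᵥ W Y Y′ (W⊆₀ b) (W⊆₀ b′) (g , Wg≢0 , Yg≡0 , Y′g≡0))
                                (∘ᵥ-⊂₀ˡ Y Y′ extra))

      other-agrees-with-W : ∀ {Y Y′} → Between Y → Between Y′ → Differ Y Y′ →
        ∀ g → W ⟨ g ⟩ ≢ 0ₛ → Y ⟨ g ⟩ ≡ 0ₛ → Y′ ⟨ g ⟩ ≡ W ⟨ g ⟩
      other-agrees-with-W {Y} {Y′} b b′ differ g Wg≢0 Yg≡0 with Y′ ⟨ g ⟩ ≟ₛ 0ₛ | differ
      ... | no Y′g≢0 | _ = ≤ₛ-nonzero (below b′ g) Y′g≢0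
      ... | yes Y′g≡0 | inj₁ extra = ⊥-elim (Wg≢0 (common-zero⇒W-zero b b′ extra g Yg≡0 Y′g≡0))
      ... | yes Y′g≡0 | inj₂ extra = ⊥-elim (Wg≢0 (common-zero⇒W-zero b′ b extra g Y′g≡0 Yg≡0))

      -- Either Y ∘ Z lies strictly between W and Y, or eliminating p from Z and Y gives a
      -- covector strictly between Y and X.
      no-crossing-covector : ∀ {Y Z} → Between Y → Z ∈ 𝓒 → W ⊆₀ Z →
        (∀ g → X ⟨ g ⟩ ≢ 0ₛ → Z ⟨ g ⟩ ≡ X ⟨ g ⟩) →
        (∃ λ e → W ⟨ e ⟩ ≢ 0ₛ × Y ⟨ e ⟩ ≡ 0ₛ × Z ⟨ e ⟩ ≡ 0ₛ) →
        (∃ λ p → Opposite (Z ⟨ p ⟩) (Y ⟨ p ⟩)) →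
        (∃ λ q → X ⟨ q ⟩ ≡ 0ₛ × Y ⟨ q ⟩ ≢ 0ₛ × Z ⟨ q ⟩ ≡ Y ⟨ q ⟩) → ⊥
      no-crossing-covector {Y} {Z} b Z∈ W⊆Z Z≡X (e , We≢0 , Ye≡0 , Ze≡0) (p , opp) (q , Xq≡0 , Yq≢0 , Zq≡Yq)
        with Fin.any? (λ g → (Y ⟨ g ⟩ ≟ₛ 0ₛ) ×-dec ¬? (Z ⟨ g ⟩ ≟ₛ 0ₛ))
      ... | yes (g , Yg≡0 , Zg≢0) =
        no-between-above (V2 𝓜 Y Z (covector b) Z∈) b
          (⊂₀-∘ᵥ W Y Z (W⊆₀ b) W⊆Z (e , We≢0 , Ye≡0 , Ze≡0)) (∘ᵥ-⊂₀ˡ Y Z (g , Zg≢0 , Yg≡0))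
      ... | no none = crossed (eliminate Z∈ (covector b) p opp)
        where
        crossed : ∃ (Eliminant Z Y p) → ⊥
        crossed (Z′ , Z′-elim) = no-between-below (member Z′-elim) b
          ((λ g Yg≡0 → trans (at-zeroˡ Z′-elim (Z-vanishes g Yg≡0)) Yg≡0) , p , opposite⇒≢0ʳ opp , vanishes Z′-elim)
          (Z′⊆X , q , (λ Z′q≡0 → Yq≢0 (trans (sym (at-agreement Z′-elim Zq≡Yq)) Z′q≡0)) , Xq≡0)
          where
          Z-vanishes : Y ⊆₀ Z
          Z-vanishes g Yg≡0 with Z ⟨ g ⟩ ≟ₛ 0ₛ
          ... | yes Zg≡0 = Zg≡0
          ... | no Zg≢0 = ⊥-elim (none (g , Yg≡0 , Zg≢0))
          Z′⊆X : Z′ ⊆₀ X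
          Z′⊆X g Z′g≡0 with X ⟨ g ⟩ ≟ₛ 0ₛ
          ... | yes Xg≡0 = Xg≡0
          ... | no Xg≢0 = ⊥-elim (Xg≢0 (trans (sym Z′g≡X) Z′g≡0))
            where
            Z′g≡X : Z′ ⟨ g ⟩ ≡ X ⟨ g ⟩
            Z′g≡X = trans (at-agreement Z′-elim (trans (Z≡X g Xg≢0) (≤ₛ-nonzero (above b g) Xg≢0)))
                          (sym (≤ₛ-nonzero (above b g) Xg≢0))

      no-three-between : ∀ {Y₁ Y₂ Y₃} → Between Y₁ → Between Y₂ → Between Y₃ →
        Differ Y₁ Y₂ → Differ Y₁ Y₃ → Differ Y₂ Y₃ → ⊥
      no-three-between {Y₁} {Y₂} {Y₃} b₁ b₂ b₃ d₁₂ d₁₃ d₂₃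
        with e , We≢0 , Y₃e≡0 ← extraZero b₃
           | p , Wp≢0 , Y₁p≡0 ← extraZero b₁
           | q , Wq≢0 , Y₂q≡0 ← extraZero b₂ =
        crossing (eliminate (covector b₁) (X∘-∈ (covector b₂)) e
                   (subst₂ Opposite (sym Y₁e) (sym (trans (X∘-off-support Y₂ (⊆₀X b₃ e Y₃e≡0)) (cong negₛ Y₂e)))
                           (opposite-negₛʳ We≢0)))
        where
        swap : ∀ {Y Y′} → Differ Y Y′ → Differ Y′ Y
        swap = [ inj₂ , inj₁ ]′
        Y₁e : Y₁ ⟨ e ⟩ ≡ W ⟨ e ⟩
        Y₁e = other-agrees-with-W b₃ b₁ (swap {Y₁} {Y₃} d₁₃) e We≢0 Y₃e≡0
        Y₂e : Y₂ ⟨ e ⟩ ≡ W ⟨ e ⟩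
        Y₂e = other-agrees-with-W b₃ b₂ (swap {Y₂} {Y₃} d₂₃) e We≢0 Y₃e≡0
        Y₂p : Y₂ ⟨ p ⟩ ≡ W ⟨ p ⟩
        Y₂p = other-agrees-with-W b₁ b₂ d₁₂ p Wp≢0 Y₁p≡0
        Y₃p : Y₃ ⟨ p ⟩ ≡ W ⟨ p ⟩
        Y₃p = other-agrees-with-W b₁ b₃ d₁₃ p Wp≢0 Y₁p≡0
        Y₁q : Y₁ ⟨ q ⟩ ≡ W ⟨ q ⟩
        Y₁q = other-agrees-with-W b₂ b₁ (swap {Y₁} {Y₂} d₁₂) q Wq≢0 Y₂q≡0
        Y₃q : Y₃ ⟨ q ⟩ ≡ W ⟨ q ⟩
        Y₃q = other-agrees-with-W b₂ b₃ d₂₃ q Wq≢0 Y₂q≡0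
        crossing : ∃ (Eliminant Y₁ (X∘- Y₂) e) → ⊥
        crossing (Z , Z-elim) = no-crossing-covector b₃ (member Z-elim) W⊆Z Z≡X
          (e , We≢0 , Y₃e≡0 , vanishes Z-elim)
          (p , subst₂ Opposite (sym Zp) (sym Y₃p) (opposite-negₛˡ Wp≢0))
          (q , ⊆₀X b₂ q Y₂q≡0 , (λ Y₃q≡0 → Wq≢0 (trans (sym Y₃q) Y₃q≡0)) , trans Zq (sym Y₃q))
          where
          Zp : Z ⟨ p ⟩ ≡ negₛ (W ⟨ p ⟩)
          Zp = trans (at-zeroˡ Z-elim Y₁p≡0) (trans (X∘-off-support Y₂ (⊆₀X b₁ p Y₁p≡0)) (cong negₛ Y₂p))
          Zq : Z ⟨ q ⟩ ≡ W ⟨ q ⟩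
          Zq = trans (at-zeroʳ Z-elim (trans (X∘-off-support Y₂ (⊆₀X b₂ q Y₂q≡0)) (cong negₛ Y₂q≡0))) Y₁q
          Z≡X : ∀ g → X ⟨ g ⟩ ≢ 0ₛ → Z ⟨ g ⟩ ≡ X ⟨ g ⟩
          Z≡X g Xg≢0 =
            trans (at-agreement Z-elim (trans (sym (≤ₛ-nonzero (above b₁ g) Xg≢0)) (sym (X∘-on-support Y₂ Xg≢0))))
                  (X∘-on-support Y₂ Xg≢0)
          W⊆Z : W ⊆₀ Z
          W⊆Z g Wg≡0 = trans (at-zeroˡ Z-elim (W⊆₀ b₁ g Wg≡0)) (W⊆₀X∘- (W⊆₀ b₂) g Wg≡0)

-- Flats

module Flats {n : ℕ} (𝓜 : OrientedMatroid n) where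

  open Covectors 𝓜 public

  Flat : Subset n → Set
  Flat = IsFlat 𝓜

  matches-unique : ∀ {ε T T′} → Matches 𝓜 ε T → Matches 𝓜 ε T′ → T ≡ T′
  matches-unique {ε} {T} {T′} T~ε T′~ε = lookup-ext T T′ λ e → case (loop? 𝓜 e)
    where
    case : ∀ {e} → Dec (Loop 𝓜 e) → T ⟨ e ⟩ ≡ T′ ⟨ e ⟩
    case {e} (yes loop) = trans (proj₁ (T~ε e) loop) (sym (proj₁ (T′~ε e) loop))
    case {e} (no ¬loop) = trans (proj₂ (T~ε e) ¬loop) (sym (proj₂ (T′~ε e) ¬loop))

  ∈zeroSet⁻ : ∀ X {g} → g ∈ₛ zeroSet 𝓜 X → X ⟨ g ⟩ ≡ 0ₛ
  ∈zeroSet⁻ X {g} g∈ = isZero-true _ (trans (sym (lookup-map g (isZero 𝓜) X)) ([]=⇒lookup g∈))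
    where
    isZero-true : ∀ s → isZero 𝓜 s ≡ true → s ≡ 0ₛ
    isZero-true 0ₛ _ = refl

  ∈zeroSet⁺ : ∀ X {g} → X ⟨ g ⟩ ≡ 0ₛ → g ∈ₛ zeroSet 𝓜 X
  ∈zeroSet⁺ X {g} Xg≡0 = lookup⇒[]= g (zeroSet 𝓜 X) (trans (lookup-map g (isZero 𝓜) X) (cong (isZero 𝓜) Xg≡0))

  zeroSet-flat : ∀ {X} → X ∈ 𝓒 → Flat (zeroSet 𝓜 X)
  zeroSet-flat = Any.map λ { refl → refl }

  ¬differ⇒zeroSet≡ : ∀ X Y → ¬ Differ X Y → zeroSet 𝓜 X ≡ zeroSet 𝓜 Y
  ¬differ⇒zeroSet≡ X Y ¬differ = ⊆-antisym (included X Y (¬differ ∘ inj₁)) (included Y X (¬differ ∘ inj₂))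
    where
    included : ∀ X Y → ¬ ExtraZero X Y → zeroSet 𝓜 X ⊆ₛ zeroSet 𝓜 Y
    included X Y ¬extra {g} g∈ with Y ⟨ g ⟩ ≟ₛ 0ₛ
    ... | yes Yg≡0 = ∈zeroSet⁺ Y Yg≡0
    ... | no Yg≢0 = ⊥-elim (¬extra (g , Yg≢0 , ∈zeroSet⁻ X g∈))

  zeroSet≢⇒differ : ∀ X Y → zeroSet 𝓜 X ≢ zeroSet 𝓜 Y → Differ X Y
  zeroSet≢⇒differ X Y X≢Y = decidable-stable (differ? X Y) (X≢Y ∘ ¬differ⇒zeroSet≡ X Y)

  zeroSet-⊂ : ∀ {U U′} → U ⊂₀ U′ → zeroSet 𝓜 U ⊂ₛ zeroSet 𝓜 U′
  zeroSet-⊂ {U} {U′} (U⊆U′ , g , U≢0 , U′≡0) =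
    (λ g∈ → ∈zeroSet⁺ U′ (U⊆U′ _ (∈zeroSet⁻ U g∈))) , g , ∈zeroSet⁺ U′ U′≡0 , U≢0 ∘ ∈zeroSet⁻ U

  proper⊂⊤ : ∀ {K} → ProperFlat 𝓜 K → K ⊂ₛ ⊤
  proper⊂⊤ (_ , K≢⊤ , _) = ⊆∧⊉⇒⊂ ⊆⊤ (K≢⊤ ∘ ⊆-antisym ⊆⊤)

  ⊤-flat : Flat ⊤
  ⊤-flat = subst Flat (⊆-antisym ⊆⊤ λ {g} _ → ∈zeroSet⁺ _ (lookup-replicate g 0ₛ)) (zeroSet-flat (V0 𝓜))

  flat-between? : ∀ A B → Dec (∃ λ K → Flat K × A ⊂ₛ K × K ⊂ₛ B)
  flat-between? A B = map′ ((λ (V , V∈ , A⊂V , V⊂B) → zeroSet 𝓜 V , zeroSet-flat V∈ , A⊂V , V⊂B) ∘ find) inside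
                           (Any.any? (λ V → (A ⊂? zeroSet 𝓜 V) ×-dec (zeroSet 𝓜 V ⊂? B)) 𝓒)
    where
    inside : (∃ λ K → Flat K × A ⊂ₛ K × K ⊂ₛ B) → Any (λ V → A ⊂ₛ zeroSet 𝓜 V × zeroSet 𝓜 V ⊂ₛ B) 𝓒
    inside (K , fK , A⊂K , K⊂B) with V , V∈ , refl ← find fK = lose V∈ (A⊂K , K⊂B)

  composeAll : List (SignVec n) → SignVec n
  composeAll = foldr _∘ᵥ_ (replicate n 0ₛ)

  composeAll-∈ : ∀ Xs → All (_∈ 𝓒) Xs → composeAll Xs ∈ 𝓒
  composeAll-∈ [] [] = V0 𝓜
  composeAll-∈ (X ∷ Xs) (X∈ ∷ Xs∈) = V2 𝓜 X (composeAll Xs) X∈ (composeAll-∈ Xs Xs∈)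

  composeAll-zero⁻ : ∀ Xs {g} → composeAll Xs ⟨ g ⟩ ≡ 0ₛ → All (λ X → X ⟨ g ⟩ ≡ 0ₛ) Xs
  composeAll-zero⁻ [] _ = []
  composeAll-zero⁻ (X ∷ Xs) {g} ≡0 = compₛ-zeroˡ _ _ ≡0′ ∷ composeAll-zero⁻ Xs (compₛ-zeroʳ _ _ ≡0′)
    where
    ≡0′ : compₛ (X ⟨ g ⟩) (composeAll Xs ⟨ g ⟩) ≡ 0ₛ
    ≡0′ = trans (sym (∘ᵥ-lookup X (composeAll Xs) g)) ≡0

  composeAll-zero⁺ : ∀ Xs {g} → All (λ X → X ⟨ g ⟩ ≡ 0ₛ) Xs → composeAll Xs ⟨ g ⟩ ≡ 0ₛ
  composeAll-zero⁺ [] {g} [] = lookup-replicate g 0ₛ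
  composeAll-zero⁺ (X ∷ Xs) {g} (≡0 ∷ ≡0s) =
    trans (∘ᵥ-lookup X (composeAll Xs) g) (compₛ-zero ≡0 (composeAll-zero⁺ Xs ≡0s))

  vanishingOn : Subset n → List (SignVec n)
  vanishingOn S = filter (λ X → S ⊆? zeroSet 𝓜 X) 𝓒

  ∈vanishingOn⁻ : ∀ {S X} → X ∈ vanishingOn S → X ∈ 𝓒 × S ⊆ₛ zeroSet 𝓜 X
  ∈vanishingOn⁻ {S} = ∈-filter⁻ (λ X → S ⊆? zeroSet 𝓜 X) {xs = 𝓒}

  closure : Subset n → Subset n
  closure S = zeroSet 𝓜 (composeAll (vanishingOn S))

  closure-flat : ∀ S → Flat (closure S)
  closure-flat S = zeroSet-flat (composeAll-∈ _ (All.tabulate (proj₁ ∘ ∈vanishingOn⁻)))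

  ⊆closure : ∀ S → S ⊆ₛ closure S
  ⊆closure S {g} g∈S =
    ∈zeroSet⁺ _ (composeAll-zero⁺ (vanishingOn S) (All.tabulate λ X∈ → ∈zeroSet⁻ _ (proj₂ (∈vanishingOn⁻ X∈) g∈S)))

  closure-least : ∀ {S K} → Flat K → S ⊆ₛ K → closure S ⊆ₛ K
  closure-least {S} fK S⊆K {g} g∈ with V , V∈ , refl ← find fK =
    ∈zeroSet⁺ V (All.lookup (composeAll-zero⁻ (vanishingOn S) (∈zeroSet⁻ _ g∈)) (∈-filter⁺ _ V∈ (λ {x} → S⊆K {x})))

  _∨ₑ_ : Subset n → Fin n → Subset n
  h ∨ₑ e = closure (h ∪ ⁅ e ⁆)

  ∨ₑ-flat : ∀ {h e} → Flat (h ∨ₑ e)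
  ∨ₑ-flat = closure-flat _

  ⊆∨ₑ : ∀ {h e} → h ⊆ₛ h ∨ₑ e
  ⊆∨ₑ {e = e} = ⊆closure _ ∘ p⊆p∪q ⁅ e ⁆

  ∈∨ₑ : ∀ {h e} → e ∈ₛ h ∨ₑ e
  ∈∨ₑ {h} {e} = ⊆closure _ (q⊆p∪q h ⁅ e ⁆ (x∈⁅x⁆ e))

  ∨ₑ-least : ∀ {h e K} → Flat K → h ⊆ₛ K → e ∈ₛ K → h ∨ₑ e ⊆ₛ K
  ∨ₑ-least fK h⊆K e∈K = closure-least fK (∪⁅⁆-least h⊆K e∈K)

  -- If e ∉ K, eliminating e from covectors of K and h (signed oppositely at e) gives a
  -- covector vanishing on h ∨ₑ e ⊇ K but not on K ∖ h.
  exchange : ∀ {h K e} → Flat h → e ∉ₛ h → Flat K → h ⊂ₛ K → K ⊆ₛ h ∨ₑ e → e ∈ₛ K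
  exchange {h} {e = e} fh e∉h fK (h⊆K , f , f∈K , f∉h) K⊆h∨e with e ∈? _
  ... | yes e∈K = e∈K
  ... | no e∉K with Y , Y∈ , refl ← find fh | X , X∈ , refl ← find fK
    with Y′ , Y′∈ , Y′e≡ , Y′⊆₀Y , Y⊆₀Y′ ← sign-adjusted Y∈ (e∉h ∘ ∈zeroSet⁺ Y) (e∉K ∘ ∈zeroSet⁺ X ∘ negₛ-zero⁻)
    with Z , Z-elim ← eliminate X∈ Y′∈ e (subst (Opposite _) (sym Y′e≡) (opposite-negₛʳ (e∉K ∘ ∈zeroSet⁺ X)))
    = ⊥-elim (f∉h (∈zeroSet⁺ Y (Y′⊆₀Y f (trans (sym (at-zeroˡ Z-elim (∈zeroSet⁻ X f∈K))) Zf≡0))))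
    where
    Zf≡0 : Z ⟨ f ⟩ ≡ 0ₛ
    Zf≡0 = ∈zeroSet⁻ Z (∨ₑ-least (zeroSet-flat (member Z-elim)) h⊆Z (∈zeroSet⁺ Z (vanishes Z-elim)) (K⊆h∨e f∈K))
      where
      h⊆Z : h ⊆ₛ zeroSet 𝓜 Z
      h⊆Z {g} g∈h = ∈zeroSet⁺ Z (trans (at-zeroˡ Z-elim (∈zeroSet⁻ X (h⊆K g∈h))) (Y⊆₀Y′ g (∈zeroSet⁻ Y g∈h)))

  ∨ₑ-strict : ∀ {h h′ e} → Flat h → Flat h′ → e ∉ₛ h′ → h ⊂ₛ h′ → h ∨ₑ e ⊂ₛ h′ ∨ₑ e
  ∨ₑ-strict fh fh′ e∉h′ h⊂h′ =
    ⊆∧⊉⇒⊂ (∨ₑ-least ∨ₑ-flat (⊆-trans (proj₁ h⊂h′) ⊆∨ₑ) ∈∨ₑ)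
           (λ h′∨e⊆h∨e → e∉h′ (exchange fh (e∉h′ ∘ proj₁ h⊂h′) fh′ h⊂h′ (⊆-trans ⊆∨ₑ h′∨e⊆h∨e)))

  infix 4 _⋖_

  _⋖_ : Subset n → Subset n → Set
  A ⋖ B = A ⊂ₛ B × Flat B × (∀ K → Flat K → A ⊂ₛ K → K ⊂ₛ B → ⊥)

  ⋖⇒⊆∨ₑ : ∀ {A B e} → Flat A → A ⋖ B → e ∈ₛ B → e ∉ₛ A → B ⊆ₛ A ∨ₑ e
  ⋖⇒⊆∨ₑ {A} {B} {e} fA (A⊂B , fB , covers) e∈B e∉A with B ⊆? A ∨ₑ e
  ... | yes B⊆A∨e = B⊆A∨e
  ... | no B⊈A∨e = ⊥-elim (covers (A ∨ₑ e) ∨ₑ-flat (⊆∧⊉⇒⊂ ⊆∨ₑ (λ A∨e⊆A → e∉A (A∨e⊆A ∈∨ₑ)))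
                                  (⊆∧⊉⇒⊂ (∨ₑ-least fB (proj₁ A⊂B) e∈B) B⊈A∨e))

  data CoverChain : Subset n → Subset n → ℕ → Set where
    done : ∀ {A} → CoverChain A A 0
    step : ∀ {A B D m} → A ⋖ B → CoverChain B D m → CoverChain A D (suc m)

  cover-chain-⊆ : ∀ {A D m} → CoverChain A D m → A ⊆ₛ D
  cover-chain-⊆ done = id
  cover-chain-⊆ (step (A⊂B , _) chain) = ⊆-trans (proj₁ A⊂B) (cover-chain-⊆ chain)

  InInterval : Subset n → Subset n → Subset n → Set
  InInterval A D h = Flat h × A ⊆ₛ h × h ⊆ₛ D

  module Raise (e : Fin n) where

    raise : List (Subset n) → List (Subset n)
    raise [] = []
    raise (h ∷ hs) with e ∈? h
    ... | yes _ = hs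
    ... | no _ = h ∨ₑ e ∷ raise hs

    length-raise : ∀ hs → length hs ≤ suc (length (raise hs))
    length-raise [] = z≤n
    length-raise (h ∷ hs) with e ∈? h
    ... | yes _ = ≤-refl
    ... | no _ = s≤s (length-raise hs)

    raise-linked : ∀ hs → Linked _⊂ₛ_ hs → All Flat hs → Linked _⊂ₛ_ (raise hs)
    raise-linked [] _ _ = []
    raise-linked (h ∷ hs) linked _ with e ∈? h
    ... | yes _ = Linked.tail linked
    raise-linked (h ∷ []) _ _ | no _ = [-]
    raise-linked (h ∷ h′ ∷ hs) (h⊂h′ ∷ linked) (fh ∷ fh′ ∷ flats) | no e∉h
      with e ∈? h′ | raise-linked (h′ ∷ hs) linked (fh′ ∷ flats)
    ... | yes e∈h′ | _ = lower-head (∨ₑ-least fh′ (proj₁ h⊂h′) e∈h′) linked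
    ... | no e∉h′ | raised = ∨ₑ-strict fh fh′ e∉h′ h⊂h′ ∷ raised

    raise-in-interval : ∀ {A D F} → Flat D → F ⊆ₛ A ∨ₑ e → e ∈ₛ F → F ⊆ₛ D →
      ∀ hs → Linked _⊂ₛ_ hs → All (InInterval A D) hs → All (InInterval F D) (raise hs)
    raise-in-interval {A} {D} {F} fD F⊆A∨e e∈F F⊆D = go
      where
      F⊆ : ∀ {K} → Flat K → A ⊆ₛ K → e ∈ₛ K → F ⊆ₛ K
      F⊆ fK A⊆K e∈K = ⊆-trans F⊆A∨e (∨ₑ-least fK A⊆K e∈K)
      go : ∀ hs → Linked _⊂ₛ_ hs → All (InInterval A D) hs → All (InInterval F D) (raise hs)
      go [] _ [] = []
      go (h ∷ hs) linked ((fh , A⊆h , h⊆D) ∷ inside) with e ∈? h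
      ... | yes e∈h =
        All.zipWith (λ ((fx , A⊆x , x⊆D) , h⊂x) → fx , (λ {_} → F⊆ fx A⊆x (proj₁ h⊂x e∈h)) , (λ {_} → x⊆D))
                    (inside , linked-head-below linked)
      ... | no _ = (∨ₑ-flat , (λ {_} → F⊆ ∨ₑ-flat (⊆-trans A⊆h ⊆∨ₑ) ∈∨ₑ) , (λ {_} → ∨ₑ-least fD h⊆D (F⊆D e∈F)))
                   ∷ go hs (Linked.tail linked) inside

  chain-in-point-interval : ∀ {A} hs → Linked _⊂ₛ_ hs → All (InInterval A A) hs → length hs ≤ 1
  chain-in-point-interval [] _ _ = z≤n
  chain-in-point-interval (_ ∷ []) _ _ = s≤s z≤n
  chain-in-point-interval (_ ∷ _ ∷ _) ((_ , x , x∈h′ , x∉h) ∷ _) ((_ , A⊆h , _) ∷ (_ , _ , h′⊆A) ∷ _) =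
    ⊥-elim (x∉h (A⊆h (h′⊆A x∈h′)))

  chain-length≤cover-length : ∀ {A D m} → Flat A → Flat D → CoverChain A D m →
    ∀ hs → Linked _⊂ₛ_ hs → All (InInterval A D) hs → length hs ≤ suc m
  chain-length≤cover-length _ _ done = chain-in-point-interval
  chain-length≤cover-length fA fD (step A⋖B@((_ , e , e∈B , e∉A) , fB , _) chain) hs linked inside =
    ≤-trans (length-raise hs)
            (s≤s (chain-length≤cover-length fB fD chain (raise hs) (raise-linked hs linked (All.map proj₁ inside))
                    (raise-in-interval fD (⋖⇒⊆∨ₑ fA A⋖B e∈B e∉A) e∈B (cover-chain-⊆ chain) hs linked inside)))
    where open Raise e

  interior-chain-length<cover-length : ∀ {A D m} → Flat A → Flat D → A ⊂ₛ D → CoverChain A D m →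
    ∀ hs → Linked _⊂ₛ_ hs → All (λ h → Flat h × A ⊂ₛ h × h ⊂ₛ D) hs → length hs < m
  interior-chain-length<cover-length {A} {D} fA fD A⊂D chain hs linked inside =
    s≤s⁻¹ (≤-trans (≤-reflexive (cong suc (sym (length-++-comm hs (D ∷ [])))))
                   (chain-length≤cover-length fA fD chain (A ∷ hs ∷ʳ D) extended-linked extended-inside))
    where
    extended-linked : Linked _⊂ₛ_ (A ∷ hs ∷ʳ D)
    extended-linked = linked-∷ (All-++⁺ (All.map (proj₁ ∘ proj₂) inside) (A⊂D ∷ []))
                               (linked-∷ʳ linked (All.map (proj₂ ∘ proj₂) inside))
    extended-inside : All (InInterval A D) (A ∷ hs ∷ʳ D)
    extended-inside = (fA , id , proj₁ A⊂D) ∷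
      All-++⁺ (All.map (λ (fh , A⊂h , h⊂D) → fh , (λ {_} → proj₁ A⊂h) , (λ {_} → proj₁ h⊂D)) inside)
              ((fD , (λ {_} → proj₁ A⊂D) , id) ∷ [])

-- Topes

module Topes {n : ℕ} (𝓜 : OrientedMatroid n) {T : SignVec n} (T-tope : IsTope 𝓜 T) where

  open Flats 𝓜 public

  T∈ : T ∈ 𝓒
  T∈ = proj₁ T-tope

  tope-nonzero : ∀ {e} → ¬ Loop 𝓜 e → T ⟨ e ⟩ ≢ 0ₛ
  tope-nonzero {e} ¬loop Te≡0 with X , X∈ , Xe≢0 ← find (¬All⇒Any¬ (λ X → X ⟨ e ⟩ ≟ₛ 0ₛ) 𝓒 ¬loop) =
    Xe≢0 (begin
      X ⟨ e ⟩                        ≡⟨ cong (λ s → compₛ s _) Te≡0 ⟨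
      compₛ (T ⟨ e ⟩) (X ⟨ e ⟩)      ≡⟨ ∘ᵥ-lookup T X e ⟨
      (T ∘ᵥ X) ⟨ e ⟩                 ≡⟨ cong (_⟨ e ⟩) T≡T∘X ⟨
      T ⟨ e ⟩                        ≡⟨ Te≡0 ⟩
      0ₛ                             ∎)
    where
    open ≡-Reasoning
    T≡T∘X : T ≡ T ∘ᵥ X
    T≡T∘X = All.lookup (proj₂ T-tope) (V2 𝓜 T X T∈ X∈)
              (extensional⇒inductive (ext λ g → subst (T ⟨ g ⟩ ≤ₛ_) (sym (∘ᵥ-lookup T X g)) (≤ₛ-compₛ _ _)))

  zero⇒loop : ∀ {g} → T ⟨ g ⟩ ≡ 0ₛ → Loop 𝓜 g
  zero⇒loop {g} Tg≡0 with loop? 𝓜 g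
  ... | yes loop = loop
  ... | no ¬loop = ⊥-elim (tope-nonzero ¬loop Tg≡0)

  loops : Subset n
  loops = zeroSet 𝓜 T

  loops-flat : Flat loops
  loops-flat = zeroSet-flat T∈

  loop∈flat : ∀ {K g} → Flat K → Loop 𝓜 g → g ∈ₛ K
  loop∈flat fK loop with V , V∈ , refl ← find fK = ∈zeroSet⁺ V (All.lookup loop V∈)

  loops⊆flat : ∀ {K} → Flat K → loops ⊆ₛ K
  loops⊆flat fK g∈ = loop∈flat fK (zero⇒loop (∈zeroSet⁻ T g∈))

  proper⇒loops⊂ : ∀ {K} → ProperFlat 𝓜 K → loops ⊂ₛ K
  proper⇒loops⊂ (fK , _ , e , e∈K , ¬loop) = loops⊆flat fK , e , e∈K , tope-nonzero ¬loop ∘ ∈zeroSet⁻ T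

  T∖_ : Subset n → SignVec n
  T∖ F = _∖ₜ_ 𝓜 T F

  Admissible : Subset n → Set
  Admissible F = (T∖ F) ∈ 𝓒

  T∖-lookup : ∀ F g → (T∖ F) ⟨ g ⟩ ≡ (if lookup F g then 0ₛ else T ⟨ g ⟩)
  T∖-lookup F g = lookup-zipWith (λ t b → if b then 0ₛ else t) g T F

  T∖-∈ : ∀ {F g} → g ∈ₛ F → (T∖ F) ⟨ g ⟩ ≡ 0ₛ
  T∖-∈ {F} {g} g∈F rewrite T∖-lookup F g | []=⇒lookup g∈F = refl

  T∖-∉ : ∀ {F g} → g ∉ₛ F → (T∖ F) ⟨ g ⟩ ≡ T ⟨ g ⟩
  T∖-∉ {F} {g} g∉F rewrite T∖-lookup F g with lookup F g in eq
  ... | true = ⊥-elim (g∉F (lookup⇒[]= g F eq))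
  ... | false = refl

  T∖-zero : ∀ {F g} → Flat F → (T∖ F) ⟨ g ⟩ ≡ 0ₛ → g ∈ₛ F
  T∖-zero {F} {g} fF ≡0 with g ∈? F
  ... | yes g∈F = g∈F
  ... | no g∉F = loop∈flat fF (zero⇒loop (trans (sym (T∖-∉ g∉F)) ≡0))

  T∖-antitone : ∀ {A B} → A ⊆ₛ B → T∖ B ≼ T∖ A
  T∖-antitone {A} {B} A⊆B g with g ∈? B
  ... | yes g∈B = subst (_≤ₛ _) (sym (T∖-∈ g∈B)) 0≤
  ... | no g∉B = subst (_ ≤ₛ_) (trans (T∖-∉ g∉B) (sym (T∖-∉ (g∉B ∘ A⊆B)))) refl≤

  T∖≼T : ∀ A → T∖ A ≼ T
  T∖≼T A g with g ∈? A
  ... | yes g∈A = subst (_≤ₛ _) (sym (T∖-∈ g∈A)) 0≤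
  ... | no g∉A = subst (_≤ₛ _) (sym (T∖-∉ g∉A)) refl≤

  T∖zeroSet : ∀ {Y} → Y ≼ T → T∖ (zeroSet 𝓜 Y) ≡ Y
  T∖zeroSet {Y} Y≼T = lookup-ext _ _ λ g → case-zero g (Y ⟨ g ⟩ ≟ₛ 0ₛ)
    where
    case-zero : ∀ g → Dec (Y ⟨ g ⟩ ≡ 0ₛ) → (T∖ zeroSet 𝓜 Y) ⟨ g ⟩ ≡ Y ⟨ g ⟩
    case-zero g (yes Yg≡0) = trans (T∖-∈ (∈zeroSet⁺ Y Yg≡0)) (sym Yg≡0)
    case-zero g (no Yg≢0) = trans (T∖-∉ (Yg≢0 ∘ ∈zeroSet⁻ Y)) (sym (≤ₛ-nonzero (Y≼T g) Yg≢0))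

  zeroSet-T∖ : ∀ {F} → Flat F → zeroSet 𝓜 (T∖ F) ≡ F
  zeroSet-T∖ {F} fF = ⊆-antisym (T∖-zero fF ∘ ∈zeroSet⁻ (T∖ F)) (∈zeroSet⁺ (T∖ F) ∘ T∖-∈)

  ⊤-admissible : Admissible ⊤
  ⊤-admissible = subst (_∈ 𝓒) (lookup-ext _ _ λ g → trans (lookup-replicate g 0ₛ) (sym (T∖-∈ ∈⊤))) (V0 𝓜)

  loops-admissible : Admissible loops
  loops-admissible = subst (_∈ 𝓒) (sym (T∖zeroSet λ _ → refl≤)) T∈

  T∖-nonzero : ∀ {A g} → Flat A → g ∉ₛ A → (T∖ A) ⟨ g ⟩ ≢ 0ₛ
  T∖-nonzero fA g∉A ≡0 = g∉A (loops⊆flat fA (∈zeroSet⁺ T (trans (sym (T∖-∉ g∉A)) ≡0)))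

  ⊂₀⇒⊂ˡ : ∀ {A U} → T∖ A ⊂₀ U → A ⊂ₛ zeroSet 𝓜 U
  ⊂₀⇒⊂ˡ {A} {U} (A⊆U , g , ≢0 , Ug≡0) =
    (λ g∈ → ∈zeroSet⁺ U (A⊆U _ (T∖-∈ g∈))) , g , ∈zeroSet⁺ U Ug≡0 , ≢0 ∘ T∖-∈

  ⊂₀⇒⊂ʳ : ∀ {B U} → Flat B → U ⊂₀ T∖ B → zeroSet 𝓜 U ⊂ₛ B
  ⊂₀⇒⊂ʳ {B} {U} fB (U⊆B , g , U≢0 , Bg≡0) =
    (λ g∈ → T∖-zero fB (U⊆B _ (∈zeroSet⁻ U g∈))) , g , T∖-zero fB Bg≡0 , U≢0 ∘ ∈zeroSet⁻ U

  ⊂⇒⊂₀ˡ : ∀ {A U} → Flat A → A ⊂ₛ zeroSet 𝓜 U → T∖ A ⊂₀ U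
  ⊂⇒⊂₀ˡ {A} {U} fA (A⊆U , g , g∈U , g∉A) =
    (λ h ≡0 → ∈zeroSet⁻ U (A⊆U (T∖-zero fA ≡0))) , g , T∖-nonzero fA g∉A , ∈zeroSet⁻ U g∈U

  ⊂⇒⊂₀ʳ : ∀ {B U} → zeroSet 𝓜 U ⊂ₛ B → U ⊂₀ T∖ B
  ⊂⇒⊂₀ʳ {B} {U} (U⊆B , g , g∈B , g∉U) =
    (λ h ≡0 → T∖-∈ (U⊆B (∈zeroSet⁺ U ≡0))) , g , g∉U ∘ ∈zeroSet⁺ U , T∖-∈ g∈B

-- Extensions of a codimension one chain

module Extensions {n : ℕ} (𝓜 : OrientedMatroid n) {T : SignVec n} (T-tope : IsTope 𝓜 T)
  (τ : List (Subset n)) (τ-chain : IsChain 𝓜 τ) (τ-bound : ∀ 𝓖 → IsChain 𝓜 𝓖 → length 𝓖 ≤ suc (length τ))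
  (τ-admissible : All (Topes.Admissible 𝓜 T-tope) τ) where

  open Topes 𝓜 T-tope public
  open StrictChains (⊂-trans {n = n}) (⊂-irref {n = n}) (_⊂?_ {n = n}) public

  Extension : Subset n → Set
  Extension H = ProperFlat 𝓜 H × All (Comparable H) τ × H ∉ τ

  insert-chain : ∀ {H xs} → IsChain 𝓜 xs → ProperFlat 𝓜 H → All (Comparable H) xs → IsChain 𝓜 (insert H xs)
  insert-chain {H} {xs} (proper , linked) properH cmps =
    All-insert properH proper , insert-linked H xs linked cmps

  extension-chain : ∀ {H} → Extension H → IsChain 𝓜 (insert H τ)
  extension-chain (properH , cmps , _) = insert-chain τ-chain properH cmps

  extensions-unnested : ∀ {H H′} → Extension H → Extension H′ → ¬ H ⊂ₛ H′
  extensions-unnested {H} {H′} H-ext (properH′ , cmps′ , _) H⊂H′ =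
    <⇒≱ (s≤s ≤-refl)
        (≤-trans (≤-reflexive (sym (trans (length-insert H′ (insert H τ)) (cong suc (length-insert H τ)))))
                 (τ-bound _ (insert-chain (extension-chain H-ext) properH′ (All-insert (inj₁ H⊂H′) cmps′))))

  record Gap (A B : Subset n) : Set where
    field
      lower : A ≡ loops ⊎ A ∈ τ
      upper : B ≡ ⊤ ⊎ B ∈ τ
      separates : ∀ {F} → F ∈ τ → F ⊆ₛ A ⊎ B ⊆ₛ F
      strict : A ⊂ₛ B

    lower-flat : Flat A
    lower-flat = [ (λ { refl → loops-flat }) , (λ A∈τ → proj₁ (All.lookup (proj₁ τ-chain) A∈τ)) ]′ lower

    lower-admissible : Admissible A
    lower-admissible = [ (λ { refl → loops-admissible }) , All.lookup τ-admissible ]′ lower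

    upper-flat : Flat B
    upper-flat = [ (λ { refl → ⊤-flat }) , (λ B∈τ → proj₁ (All.lookup (proj₁ τ-chain) B∈τ)) ]′ upper

    upper-admissible : Admissible B
    upper-admissible = [ (λ { refl → ⊤-admissible }) , All.lookup τ-admissible ]′ upper

    inside⇒extension : ∀ {K} → Flat K → A ⊂ₛ K → K ⊂ₛ B → Extension K
    inside⇒extension {K} fK A⊂K@(_ , e , e∈K , e∉A) K⊂B@(_ , b , b∈B , b∉K) =
      (fK , (λ { refl → b∉K ∈⊤ }) , e , e∈K , e∉A ∘ loop∈flat lower-flat) ,
      All.tabulate (comparable ∘ separates) , (outside ∘ separates)
      where
      comparable : ∀ {F} → F ⊆ₛ A ⊎ B ⊆ₛ F → Comparable K F
      comparable (inj₁ F⊆A) = inj₁ (⊆-⊂-trans F⊆A A⊂K)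
      comparable (inj₂ B⊆F) = inj₂ (⊂-⊆-trans K⊂B B⊆F)
      outside : K ⊆ₛ A ⊎ B ⊆ₛ K → ⊥
      outside (inj₁ K⊆A) = e∉A (K⊆A e∈K)
      outside (inj₂ B⊆K) = b∉K (B⊆K b∈B)

    extension-vs-lower : ∀ {H} → Extension H → A ⊂ₛ H ⊎ H ⊆ₛ A
    extension-vs-lower {H} (properH , cmps , _) with lower
    ... | inj₁ refl = inj₁ (proper⇒loops⊂ properH)
    ... | inj₂ A∈τ = [ inj₁ , inj₂ ∘ proj₁ ]′ (All.lookup cmps A∈τ)

    extension-vs-upper : ∀ {H} → Extension H → H ⊂ₛ B ⊎ B ⊆ₛ H
    extension-vs-upper {H} (properH , cmps , _) with upper
    ... | inj₁ refl = inj₁ (proper⊂⊤ properH)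
    ... | inj₂ B∈τ = [ inj₂ ∘ proj₁ , inj₁ ]′ (All.lookup cmps B∈τ)

  AdmissibleExtension : Subset n → Set
  AdmissibleExtension H = Extension H × Admissible H

  module InGap {A B} (gap : Gap A B) where

    open Gap gap
    open Interval upper-admissible lower-admissible (T∖-antitone (proj₁ strict))

    rank≤2 : IntervalRank≤2
    rank≤2 U U′ U∈ U′∈ A⊂U U⊂U′ U′⊂B =
      extensions-unnested (extension U∈ (⊂₀⇒⊂ˡ A⊂U) (⊂-trans U⊂ₛU′ U′⊂ₛB))
                          (extension U′∈ (⊂-trans (⊂₀⇒⊂ˡ A⊂U) U⊂ₛU′) U′⊂ₛB) U⊂ₛU′
      where
      U⊂ₛU′ : zeroSet 𝓜 U ⊂ₛ zeroSet 𝓜 U′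
      U⊂ₛU′ = zeroSet-⊂ U⊂U′
      U′⊂ₛB : zeroSet 𝓜 U′ ⊂ₛ B
      U′⊂ₛB = ⊂₀⇒⊂ʳ upper-flat U′⊂B
      extension : ∀ {V} → V ∈ 𝓒 → A ⊂ₛ zeroSet 𝓜 V → zeroSet 𝓜 V ⊂ₛ B → Extension (zeroSet 𝓜 V)
      extension V∈ = inside⇒extension (zeroSet-flat V∈)

    between⇒extension : ∀ {Y} → Between Y → Extension (zeroSet 𝓜 Y)
    between⇒extension b = inside⇒extension (zeroSet-flat (covector b)) (⊂₀⇒⊂ˡ (W⊂₀ b)) (⊂₀⇒⊂ʳ upper-flat (⊂₀X b))

    between⇒admissible-extension : ∀ {Y} → Between Y → AdmissibleExtension (zeroSet 𝓜 Y)
    between⇒admissible-extension b =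
      between⇒extension b ,
      subst (_∈ 𝓒) (sym (T∖zeroSet λ g → ≤ₛ-trans (below b g) (T∖≼T A g))) (covector b)

    admissible-inside⇒between : ∀ {H} → Flat H → Admissible H → A ⊂ₛ H → H ⊂ₛ B → Between (T∖ H)
    admissible-inside⇒between fH H-adm A⊂H H⊂B = record
      { covector = H-adm
      ; above = T∖-antitone (proj₁ H⊂B)
      ; below = T∖-antitone (proj₁ A⊂H)
      ; extraZero = proj₂ (⊂⇒⊂₀ˡ lower-flat (subst (A ⊂ₛ_) (sym (zeroSet-T∖ fH)) A⊂H))
      ; extraSupport = proj₂ (⊂⇒⊂₀ʳ (subst (_⊂ₛ B) (sym (zeroSet-T∖ fH)) H⊂B))
      }

    no-third-admissible-extension : ∀ {Y₁ Y₂ H} → Between Y₁ → Between Y₂ → zeroSet 𝓜 Y₁ ≢ zeroSet 𝓜 Y₂ →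
      AdmissibleExtension H → zeroSet 𝓜 Y₁ ≢ H → zeroSet 𝓜 Y₂ ≢ H → ⊥
    no-third-admissible-extension {Y₁} {Y₂} {H} b₁ b₂ Y₁≢Y₂ (H-ext , H-adm) Y₁≢H Y₂≢H
      with extension-vs-lower H-ext | extension-vs-upper H-ext
    ... | inj₂ H⊆A | _ = extensions-unnested H-ext (between⇒extension b₁) (⊆-⊂-trans H⊆A (⊂₀⇒⊂ˡ (W⊂₀ b₁)))
    ... | inj₁ _ | inj₂ B⊆H =
      extensions-unnested (between⇒extension b₁) H-ext (⊂-⊆-trans (⊂₀⇒⊂ʳ upper-flat (⊂₀X b₁)) B⊆H)
    ... | inj₁ A⊂H | inj₁ H⊂B =
      no-three-between rank≤2 b₁ b₂ (admissible-inside⇒between fH H-adm A⊂H H⊂B)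
        (zeroSet≢⇒differ Y₁ Y₂ Y₁≢Y₂)
        (zeroSet≢⇒differ Y₁ (T∖ _) (λ eq → Y₁≢H (trans eq (zeroSet-T∖ fH))))
        (zeroSet≢⇒differ Y₂ (T∖ _) (λ eq → Y₂≢H (trans eq (zeroSet-T∖ fH))))
      where
      fH : Flat H
      fH = proj₁ (proj₁ H-ext)

    exactly-two : ∀ {K} → Flat K → A ⊂ₛ K → K ⊂ₛ B → ExactlyTwo AdmissibleExtension
    exactly-two fK A⊂K K⊂B with V , V∈ , refl ← find fK
      with Y₁ , b₁ ← between-of V∈ (⊂⇒⊂₀ˡ lower-flat A⊂K) (⊂⇒⊂₀ʳ K⊂B)
      with Y₂ , b₂ , g , Y₂g≢0 , Y₁g≡0 ← another-between b₁ = record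
      { first = zeroSet 𝓜 Y₁
      ; second = zeroSet 𝓜 Y₂
      ; first≢second = Y₁≢Y₂
      ; first-P = between⇒admissible-extension b₁
      ; second-P = between⇒admissible-extension b₂
      ; only = only
      }
      where
      Y₁≢Y₂ : zeroSet 𝓜 Y₁ ≢ zeroSet 𝓜 Y₂
      Y₁≢Y₂ eq = Y₂g≢0 (∈zeroSet⁻ Y₂ (subst (g ∈ₛ_) eq (∈zeroSet⁺ Y₁ Y₁g≡0)))
      only : ∀ {H} → AdmissibleExtension H → H ≡ zeroSet 𝓜 Y₁ ⊎ H ≡ zeroSet 𝓜 Y₂
      only {H} H-ae with H ≟ˢ zeroSet 𝓜 Y₁ | H ≟ˢ zeroSet 𝓜 Y₂
      ... | yes H≡Y₁ | _ = inj₁ H≡Y₁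
      ... | no _ | yes H≡Y₂ = inj₂ H≡Y₂
      ... | no H≢Y₁ | no H≢Y₂ = ⊥-elim (no-third-admissible-extension b₁ b₂ Y₁≢Y₂ H-ae (H≢Y₁ ∘ sym) (H≢Y₂ ∘ sym))

  gap-or-cover : ∀ A rest → A ≡ loops ⊎ A ∈ τ → (∀ {F} → F ∈ τ → F ∈ rest ⊎ F ⊆ₛ A) → rest ⊆ τ →
    Linked _⊂ₛ_ (A ∷ rest) → A ⊂ₛ ⊤ → ExactlyTwo AdmissibleExtension ⊎ CoverChain A ⊤ (suc (length rest))
  gap-or-cover A [] A-end below _ _ A⊂⊤ with flat-between? A ⊤
  ... | yes (K , fK , A⊂K , K⊂⊤) = inj₁ (InGap.exactly-two gap fK A⊂K K⊂⊤)
    where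
    gap : Gap A ⊤
    gap = record { lower = A-end ; upper = inj₁ refl ; separates = inj₁ ∘ [ (λ ()) , id ]′ ∘ below ; strict = A⊂⊤ }
  ... | no none = inj₂ (step (A⊂⊤ , ⊤-flat , λ K fK A⊂K K⊂⊤ → none (K , fK , A⊂K , K⊂⊤)) done)
  gap-or-cover A (F ∷ rest) A-end below rest⊆τ (A⊂F ∷ linked) _ with flat-between? A F
  ... | yes (K , fK , A⊂K , K⊂F) = inj₁ (InGap.exactly-two gap fK A⊂K K⊂F)
    where
    separates : ∀ {G} → G ∈ τ → G ⊆ₛ A ⊎ F ⊆ₛ G
    separates G∈ with below G∈
    ... | inj₁ (here refl) = inj₂ id
    ... | inj₁ (there G∈rest) = inj₂ (proj₁ (All.lookup (linked-head-below linked) G∈rest))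
    ... | inj₂ G⊆A = inj₁ G⊆A
    gap : Gap A F
    gap = record { lower = A-end ; upper = inj₂ (rest⊆τ (here refl)) ; separates = separates ; strict = A⊂F }
  ... | no none =
    Sum.map₂ (step (A⊂F , proj₁ F-proper , λ K fK A⊂K K⊂F → none (K , fK , A⊂K , K⊂F)))
      (gap-or-cover F rest (inj₂ (rest⊆τ (here refl))) below′ (rest⊆τ ∘ there) linked (proper⊂⊤ F-proper))
    where
    F-proper : ProperFlat 𝓜 F
    F-proper = All.lookup (proj₁ τ-chain) (rest⊆τ (here refl))
    below′ : ∀ {G} → G ∈ τ → G ∈ rest ⊎ G ⊆ₛ F
    below′ G∈ with below G∈
    ... | inj₁ (here refl) = inj₂ id
    ... | inj₁ (there G∈rest) = inj₁ G∈rest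
    ... | inj₂ G⊆A = inj₂ (⊆-trans G⊆A (proj₁ A⊂F))

  exactly-two-admissible-extensions : (∃ λ 𝓖 → IsChain 𝓜 𝓖 × length 𝓖 ≡ suc (length τ)) →
    ExactlyTwo AdmissibleExtension
  exactly-two-admissible-extensions (𝓖@(G ∷ _) , (𝓖-proper@(G-proper ∷ _) , 𝓖-linked) , 𝓖-length) =
    [ id , (λ chain → ⊥-elim (<-irrefl 𝓖-length (𝓖-short chain))) ]′
      (gap-or-cover loops τ (inj₁ refl) inj₁ id (linked-∷ (All.map proper⇒loops⊂ (proj₁ τ-chain)) (proj₂ τ-chain)) loops⊂⊤)
    where
    loops⊂⊤ : loops ⊂ₛ ⊤
    loops⊂⊤ = ⊂-trans (proper⇒loops⊂ G-proper) (proper⊂⊤ G-proper)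
    𝓖-short : CoverChain loops ⊤ (suc (length τ)) → length 𝓖 < suc (length τ)
    𝓖-short chain = interior-chain-length<cover-length loops-flat ⊤-flat loops⊂⊤ chain 𝓖 𝓖-linked
                      (All.map (λ p → proj₁ p , proper⇒loops⊂ p , proper⊂⊤ p) 𝓖-proper)

  insert-facet : ∀ {H} → Extension H → IsFacet 𝓜 (insert H τ)
  insert-facet {H} H-ext = chain , λ 𝓖 𝓖-chain ⊆𝓖 →
    unique-⊆-length≥⇒⊇ _≟ˢ_ (linked⇒unique (proj₂ chain)) ⊆𝓖
      (subst (length 𝓖 ≤_) (sym (length-insert H τ)) (τ-bound 𝓖 𝓖-chain))
    where
    chain : IsChain 𝓜 (insert H τ)
    chain = extension-chain H-ext

  facet-through-τ : ∀ {G 𝓕} → Extension G → IsFacet 𝓜 𝓕 → τ ⊆ 𝓕 →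
    ∃ λ H → Extension H × H ∈ 𝓕 × 𝓕 ≡ insert H τ
  facet-through-τ {G} {𝓕} G-ext@(_ , _ , G∉τ) (𝓕-chain@(𝓕-proper , 𝓕-linked) , maximal) τ⊆𝓕
    with Any.any? (λ H → ¬? (Any.any? (H ≟ˢ_) τ)) 𝓕
  ... | no none = ⊥-elim (G∉τ (𝓕⊆τ (maximal _ (extension-chain G-ext) (insert-⊇ G τ ∘ 𝓕⊆τ) (∈-insert G τ))))
    where
    𝓕⊆τ : 𝓕 ⊆ τ
    𝓕⊆τ {H} H∈𝓕 = decidable-stable (Any.any? (H ≟ˢ_) τ) λ H∉τ → none (lose H∈𝓕 H∉τ)
  ... | yes some with H , H∈𝓕 , H∉τ ← find some = H , H-ext , H∈𝓕 ,
    allPairs-≡ 𝓕-sorted (Linked⇒AllPairs ⊂-trans (proj₂ (extension-chain H-ext))) 𝓕⊆ ⊆𝓕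
    where
    𝓕-sorted : AllPairs _⊂ₛ_ 𝓕
    𝓕-sorted = Linked⇒AllPairs ⊂-trans 𝓕-linked
    H-ext : Extension H
    H-ext = All.lookup 𝓕-proper H∈𝓕 ,
            All.tabulate (λ F∈τ → allPairs-comparable 𝓕-sorted (τ⊆𝓕 F∈τ) H∈𝓕 λ { refl → H∉τ F∈τ }) , H∉τ
    ⊆𝓕 : insert H τ ⊆ 𝓕
    ⊆𝓕 F∈ = [ (λ { refl → H∈𝓕 }) , τ⊆𝓕 ]′ (∈-insert⁻ H τ F∈)
    𝓕⊆ : 𝓕 ⊆ insert H τ
    𝓕⊆ = unique-⊆-length≥⇒⊇ _≟ˢ_ (linked⇒unique (proj₂ (extension-chain H-ext))) ⊆𝓕
           (subst (length 𝓕 ≤_) (sym (length-insert H τ)) (τ-bound 𝓕 𝓕-chain))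

  insert-injective : ∀ {G H} → G ∉ τ → insert G τ ≡ insert H τ → G ≡ H
  insert-injective {G} {H} G∉τ eq = [ id , ⊥-elim ∘ G∉τ ]′ (∈-insert⁻ H τ (subst (G ∈_) eq (∈-insert G τ)))

  module _ (ε : Vec Bool n) (T~ε : Matches 𝓜 ε T) where

    InE⇒admissible : ∀ {𝓕} → InE 𝓜 𝓕 ε → All Admissible 𝓕
    InE⇒admissible 𝓕∋ε with T′ , _ , (_ , T′∖𝓕) , T′~ε ← find 𝓕∋ε =
      subst (λ T″ → All (λ F → _∖ₜ_ 𝓜 T″ F ∈ 𝓒) _) (matches-unique {ε} T′~ε T~ε) T′∖𝓕

    insert-InE : ∀ {H} → Admissible H → InE 𝓜 (insert H τ) ε
    insert-InE H-adm = lose T∈ ((T-tope , All-insert H-adm τ-admissible) , T~ε)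

    facets-with-ε : ∀ {σs} → Unique σs →
      (∀ 𝓕 → (𝓕 ∈ σs → IsFacet 𝓜 𝓕 × τ ⊆ 𝓕) × (IsFacet 𝓜 𝓕 × τ ⊆ 𝓕 → 𝓕 ∈ σs)) →
      ExactlyTwo AdmissibleExtension → length (filter (λ 𝓕 → inE? 𝓜 𝓕 ε) σs) ≡ 2
    facets-with-ε {σs} σs-unique σs-facets two =
      length-unique-pair (filter⁺ _ σs-unique) (first≢second ∘ insert-injective (proj₂ (proj₂ (proj₁ first-P))))
                         (counted first-P) (counted second-P) classify
      where
      open ExactlyTwo two
      counted : ∀ {H} → AdmissibleExtension H → insert H τ ∈ filter (λ 𝓕 → inE? 𝓜 𝓕 ε) σs
      counted {H} (H-ext , H-adm) =
        ∈-filter⁺ _ (proj₂ (σs-facets _) (insert-facet H-ext , insert-⊇ H τ)) (insert-InE H-adm)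
      classify : ∀ {𝓕} → 𝓕 ∈ filter (λ 𝓕 → inE? 𝓜 𝓕 ε) σs → 𝓕 ≡ insert first τ ⊎ 𝓕 ≡ insert second τ
      classify {𝓕} 𝓕∈ with 𝓕∈σs , 𝓕∋ε ← ∈-filter⁻ (λ 𝓕 → inE? 𝓜 𝓕 ε) {xs = σs} 𝓕∈
        with 𝓕-facet , τ⊆𝓕 ← proj₁ (σs-facets 𝓕) 𝓕∈σs
        with H , H-ext , H∈𝓕 , refl ← facet-through-τ (proj₁ first-P) 𝓕-facet τ⊆𝓕 =
        Sum.map (cong (λ G → insert G τ)) (cong (λ G → insert G τ))
                (only (H-ext , All.lookup (InE⇒admissible 𝓕∋ε) H∈𝓕))

lemma3p6 : ∀ {n : ℕ} (𝓜 : OrientedMatroid n) (τ : List (Subset n)) → IsCodimOneFace 𝓜 τ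
    → (σs : List (List (Subset n))) → Unique σs
    → (∀ 𝓕 → (𝓕 ∈ σs → IsFacet 𝓜 𝓕 × τ ⊆ 𝓕) × (IsFacet 𝓜 𝓕 × τ ⊆ 𝓕 → 𝓕 ∈ σs))
    → (ε : Vec Bool n) → (∀ e → Loop 𝓜 e → lookup ε e ≡ false)
    → Any (λ 𝓕 → InE 𝓜 𝓕 ε) σs
    → 2 ∣ length (filter (λ 𝓕 → inE? 𝓜 𝓕 ε) σs)
lemma3p6 𝓜 τ (τ-chain , longer-chain , τ-bound) σs σs-unique σs-facets ε _ ε∈some
  with 𝓕₀ , 𝓕₀∈σs , ε∈𝓕₀ ← find ε∈some
  with T , _ , (T-tope , T∖𝓕₀) , T~ε ← find ε∈𝓕₀ =
  subst (2 ∣_) (sym (facets-with-ε ε T~ε σs-unique σs-facets (exactly-two-admissible-extensions longer-chain)))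
        ∣-refl
  where
  τ⊆𝓕₀ : τ ⊆ 𝓕₀
  τ⊆𝓕₀ = proj₂ (proj₁ (σs-facets 𝓕₀) 𝓕₀∈σs)
  open Extensions 𝓜 T-tope τ τ-chain τ-bound (All.tabulate (All.lookup T∖𝓕₀ ∘ τ⊆𝓕₀))
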